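{- In the setting described in the context, the average over $m\in\{0,1,\dots,2n-3\}$ of the total traveling distances of the schedules $K^*_{\mathrm{DRR}}(m)$ is at most \[(n-2)\tau' + 2\sum_{v\in V\setminus\{v^*\}} d_{vv^*} + \tfrac{3}{2}\tau + \tfrac{n\tau}{2} + \frac{1}{n-1}\sum_{v\in V}\sum_{v'\in V\setminus\{v\}} d_{vv'},\] where $\tau$ is the length of a shortest Hamilton cycle of $G$ and $\tau'$ is the length of the Hamilton cycle $(v_0,\dots,v_{n-2})$.
   Context: Teams and distances: $n\ge4$ even teams, each with a home venue; $d_{ij}\ge0$ is the distance between the home venues of teams $i,j$, with $d_{ii}=0$, symmetry and the triangle inequality. $G$ is the complete graph on the set $V$ of home venues, edge $\{v,v'\}$ having length $d_{vv'}$. A game "$i$ at $j$" is played at $j$'s venue (home for $j$, away for $i$). A double round-robin schedule has slots $0,\dots,2n-3$, each team plays exactly one game per slot, and every ordered pair of distinct teams is played exactly once. The traveling distance of a team: it starts at its home venue, travels in slot order to the venues of its games, and returns home after the last slot; the total traveling distance is the sum over teams. Construction: $v^*$ is a vertex attaining $\min_{v\in V}\sum_{v'\in V\setminus\{v\}}d_{vv'}$, and its team is named $n-1$. $(v_0,\dots,v_{n-2})$ is the Hamilton cycle on $V\setminus\{v^*\}$ produced by Christofides' 1.5-approximation algorithm, and the team with home venue $v_i$ is named $i$. For $t\in\{0,\dots,n-1\}$, $s\in\{0,\dots,n-2\}$: $K^*(t,s)=s-t\pmod{n-1}$ if $t\ne n-1$ and $s-t\not\equiv t\pmod{n-1}$;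 $K^*(t,s)=n-1$ if $t\ne n-1$ and $s-t\equiv t\pmod{n-1}$; $K^*(n-1,s)=s/2$ for $s$ even and $(s+n-1)/2$ for $s$ odd. $K^*_{\mathrm{DRR}}$: in slots $s$ and $s+n-1$ ($0\le s\le n-2$) team $t$ plays $K^*(t,s)$; for $t\in\{0,\dots,n/2-1\}$ its games in slots $2t,\dots,n+2t-2$ are home and the others away; for $t\in\{n/2,\dots,n-2\}$ its games in slots $2t-n+2,\dots,2t$ are away and the others home; team $n-1$ plays away in slots $0,\dots,n-2$ and home otherwise. $K^*_{\mathrm{DRR}}(m)$ ($0\le m\le 2n-3$) has in slot $s$ the games of $K^*_{\mathrm{DRR}}$ in slot $s+m\pmod{2n-2}$.
   Formalization: The distances $d_{ij}$ between home venues are rational, and so is the shortest Hamilton cycle length τ. -}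

module Defs where

open import Data.Nat as ℕ using (ℕ; zero; suc; _∸_; _≤ᵇ_; _<ᵇ_; _≡ᵇ_)
open import Data.Nat.DivMod using (_%_; _/_)
open import Data.Nat.Properties using (_<?_; _≟_)
open import Data.Fin using (Fin; fromℕ<; toℕ)
open import Data.Bool using (Bool; true; false; if_then_else_; _∧_; not)
open import Data.List using (List; []; _∷_; _++_; map; upTo; length; [_]; deduplicate)
open import Data.List.Membership.Propositional using (_∈_)
open import Data.List.Relation.Unary.All using (All)
open import Data.List.Relation.Binary.Permutation.Propositional using (_↭_)
open import Data.Product using (_×_; _,_; Σ; ∃)
open import Data.Integer using (+_)
open import Data.Rational as Q using (ℚ; 0ℚ)
open import Relation.Nullary using (yes; no)
open import Relation.Binary.PropositionalEquality using (_≡_)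

ℕ→ℚ : ℕ → ℚ
ℕ→ℚ k = (+ k) Q./ 1

-- 1/k for k ≥ 1 (only ever applied to positive k)
recip : ℕ → ℚ
recip zero = 0ℚ
recip (suc k) = (+ 1) Q./ suc k

Σ< : ℕ → (ℕ → ℚ) → ℚ
Σ< zero f = 0ℚ
Σ< (suc k) f = Σ< k f Q.+ f k

sumList : List ℚ → ℚ
sumList [] = 0ℚ
sumList (x ∷ xs) = x Q.+ sumList xs

-- a mod k, total (k = 0 never used)
modN : ℕ → ℕ → ℕ
modN a zero = a
modN a (suc k) = a % suc k

-- Distances.  Teams/venues are 0..n-1 (team i has venue v_i, team n-1
-- has venue v*); d i j is the distance between the venues of i and j.

IsMetric : {n : ℕ} → (Fin n → Fin n → ℚ) → Set
IsMetric {n} d =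
  (∀ i j → 0ℚ Q.≤ d i j) ×
  (∀ i → d i i ≡ 0ℚ) ×
  (∀ i j → d i j ≡ d j i) ×
  (∀ i j k → d i k Q.≤ d i j Q.+ d j k)

-- the same distance on natural-number indices (0 outside 0..n-1; never used there)
dℕ : {n : ℕ} → (Fin n → Fin n → ℚ) → ℕ → ℕ → ℚ
dℕ {n} d i j with i <? n | j <? n
... | yes p | yes q = d (fromℕ< p) (fromℕ< q)
... | _     | _     = 0ℚ

rowSum : {n : ℕ} → (Fin n → Fin n → ℚ) → ℕ → ℚ
rowSum {n} d v = Σ< n (λ v' → if v' ≡ᵇ v then 0ℚ else dℕ d v v')

IsVStar : {n : ℕ} → (Fin n → Fin n → ℚ) → Set
IsVStar {n} d = ∀ v → v ℕ.< n → rowSum d (n ∸ 1) Q.≤ rowSum d v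

lastOr : ℕ → List ℕ → ℕ
lastOr x [] = x
lastOr x (y ∷ ys) = lastOr y ys

pathLen : (ℕ → ℕ → ℚ) → List ℕ → ℚ
pathLen D (x ∷ y ∷ ys) = D x y Q.+ pathLen D (y ∷ ys)
pathLen D _ = 0ℚ

cycLen : (ℕ → ℕ → ℚ) → List ℕ → ℚ
cycLen D [] = 0ℚ
cycLen D (x ∷ xs) = pathLen D (x ∷ xs) Q.+ D (lastOr x xs) x

IsShortestHamCycleLength : {n : ℕ} → (Fin n → Fin n → ℚ) → ℚ → Set
IsShortestHamCycleLength {n} d τ =
  (∃ λ π → (π ↭ upTo n) × (cycLen (dℕ d) π ≡ τ)) ×
  (∀ π → π ↭ upTo n → τ Q.≤ cycLen (dℕ d) π)

-- Christofides' algorithm (as the relation "C is a possible output")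
-- on the complete graph with vertex list Vs and edge lengths w.

Edge : Set
Edge = ℕ × ℕ

EdgesIn : List ℕ → List Edge → Set
EdgesIn Vs E = All (λ e → (Data.Product.proj₁ e ∈ Vs) × (Data.Product.proj₂ e ∈ Vs)) E

data Reach (E : List Edge) : ℕ → ℕ → Set where
  here : ∀ {u} → Reach E u u
  fwd  : ∀ {u v x} → (u , v) ∈ E → Reach E v x → Reach E u x
  bwd  : ∀ {u v x} → (v , u) ∈ E → Reach E v x → Reach E u x

weight : (ℕ → ℕ → ℚ) → List Edge → ℚ
weight w E = sumList (map (λ e → w (Data.Product.proj₁ e) (Data.Product.proj₂ e)) E)

SpanningTree : List ℕ → List Edge → Set
SpanningTree Vs T =
  EdgesIn Vs T × (length T ≡ length Vs ∸ 1) ×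
  (∀ u v → u ∈ Vs → v ∈ Vs → Reach T u v)

MinSpanningTree : List ℕ → (ℕ → ℕ → ℚ) → List Edge → Set
MinSpanningTree Vs w T =
  SpanningTree Vs T × (∀ T' → SpanningTree Vs T' → weight w T Q.≤ weight w T')

-- degree (a loop counts twice)
deg : List Edge → ℕ → ℕ
deg [] v = 0
deg ((a , b) ∷ E) v =
  (if a ≡ᵇ v then 1 else 0) ℕ.+ (if b ≡ᵇ v then 1 else 0) ℕ.+ deg E v

PerfectMatchingOnOdd : List ℕ → List Edge → List Edge → Set
PerfectMatchingOnOdd Vs T M =
  EdgesIn Vs M ×
  (∀ v → v ∈ Vs → (deg T v % 2 ≡ 1 → deg M v ≡ 1) × (deg T v % 2 ≡ 0 → deg M v ≡ 0))

MinPerfectMatchingOnOdd : List ℕ → (ℕ → ℕ → ℚ) → List Edge → List Edge → Set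
MinPerfectMatchingOnOdd Vs w T M =
  PerfectMatchingOnOdd Vs T M ×
  (∀ M' → PerfectMatchingOnOdd Vs T M' → weight w M Q.≤ weight w M')

consecPairs : List ℕ → List Edge
consecPairs (x ∷ y ∷ ys) = (x , y) ∷ consecPairs (y ∷ ys)
consecPairs _ = []

normEdge : Edge → Edge
normEdge (u , v) = if u ≤ᵇ v then (u , v) else (v , u)

IsEulerCircuit : List Edge → ℕ → List ℕ → Set
IsEulerCircuit E w0 mid =
  map normEdge (consecPairs (w0 ∷ mid ++ [ w0 ])) ↭ map normEdge E

ChristofidesOutput : List ℕ → (ℕ → ℕ → ℚ) → List ℕ → Set
ChristofidesOutput Vs w C =
  Σ (List Edge) λ T → Σ (List Edge) λ M → Σ ℕ λ w0 → Σ (List ℕ) λ mid →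
    MinSpanningTree Vs w T ×
    MinPerfectMatchingOnOdd Vs w T M ×
    IsEulerCircuit (T ++ M) w0 mid ×
    (deduplicate _≟_ (w0 ∷ mid ++ [ w0 ]) ≡ C)

Kstar : ℕ → ℕ → ℕ → ℕ
Kstar n t s =
  if t ≡ᵇ (n ∸ 1)
  then (if s % 2 ≡ᵇ 0 then s / 2 else (s ℕ.+ (n ∸ 1)) / 2)
  else (let a = modN (s ℕ.+ (n ∸ 1) ∸ t) (n ∸ 1)
        in if a ≡ᵇ t then n ∸ 1 else a)

isHome : ℕ → ℕ → ℕ → Bool
isHome n t s' =
  if t ≡ᵇ (n ∸ 1) then not (s' ≤ᵇ (n ∸ 2))
  else if t <ᵇ (n / 2) then ((2 ℕ.* t) ≤ᵇ s') ∧ (s' ≤ᵇ (n ℕ.+ 2 ℕ.* t ∸ 2))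
  else not ((((2 ℕ.* t ℕ.+ 2) ∸ n) ≤ᵇ s') ∧ (s' ≤ᵇ 2 ℕ.* t))

loc : ℕ → ℕ → ℕ → ℕ → ℕ
loc n m t s =
  let s' = modN (s ℕ.+ m) (2 ℕ.* n ∸ 2)
  in if isHome n t s' then t else Kstar n t (modN s' (n ∸ 1))

teamDist : {n : ℕ} → (Fin n → Fin n → ℚ) → ℕ → ℕ → ℚ
teamDist {n} d m t =
  dℕ d t (loc n m t 0) Q.+
  Σ< (2 ℕ.* n ∸ 3) (λ s → dℕ d (loc n m t s) (loc n m t (suc s))) Q.+
  dℕ d (loc n m t (2 ℕ.* n ∸ 3)) t

totalDist : {n : ℕ} → (Fin n → Fin n → ℚ) → ℕ → ℚ
totalDist {n} d m = Σ< n (λ t → teamDist d m t)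

avgTotalDist : {n : ℕ} → (Fin n → Fin n → ℚ) → ℚ
avgTotalDist {n} d = recip (2 ℕ.* n ∸ 2) Q.* Σ< (2 ℕ.* n ∸ 2) (λ m → totalDist d m)

bound : {n : ℕ} → (Fin n → Fin n → ℚ) → ℚ → ℚ
bound {n} d τ =
  ℕ→ℚ (n ∸ 2) Q.* cycLen (dℕ d) (upTo (n ∸ 1)) Q.+
  ℕ→ℚ 2 Q.* Σ< (n ∸ 1) (λ v → dℕ d v (n ∸ 1)) Q.+
  ((+ 3) Q./ 2) Q.* τ Q.+
  (ℕ→ℚ n Q.* τ) Q.* ((+ 1) Q./ 2) Q.+
  recip (n ∸ 1) Q.* Σ< n (λ v → rowSum d v)

-- Write n = 2h + 2, N = n - 1 (team N owns v*) and P = 2N, the number of slots.  In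
-- K*_DRR(m) a team leaves home, follows P consecutive slots of the P-periodic venue
-- sequence of K*_DRR and returns home.
--   Walks:    summed over all P rotations, a team covers its cyclic tour P - 1 times and
--             every distance from home to a venue of the period twice.
--   Metric:   twice any distance is at most the length of a Hamilton cycle, so ≤ τ.
--   Schedule: in one period every team plays its N away games consecutively, then stays
--             home for N slots; the away trips are computed explicitly.
--   Tours:    so a team's home distances sum to its row sum; the tour of a team t < N is
--             the cycle 0, …, N-1 (length τ') with one edge detoured via v*, and the tour
--             of team N consists of n legs of length ≤ τ/2.
--   Average:  summing these over the teams gives the bound for every n = 2h + 2.
module Submission where

open import Defs
open import Data.Nat using (ℕ)
open import Data.Fin using (Fin)
open import Data.Rational using (ℚ)

module Sums where
  open import Data.Nat as ℕ using (ℕ; zero; suc; _<_)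
  import Data.Nat.Properties as ℕP
  open import Data.Nat.Coprimality as Coprime using (1-coprimeTo)
  open import Data.Integer as ℤ using (+_)
  import Data.Integer.Properties as ℤP
  open import Data.Product using (_,_)
  open import Data.Rational using (ℚ; 0ℚ; 1ℚ; mkℚ; _+_; _*_; _-_; -_; _≤_)
  import Data.Rational.Properties as QP
  import Data.Rational.Unnormalised as U
  import Data.Rational.Unnormalised.Properties as UP
  open import Data.Rational.Solver using (module +-*-Solver)
  open import Relation.Binary.PropositionalEquality
    using (_≡_; refl; sym; cong; cong₂; trans; module ≡-Reasoning)
  open +-*-Solver

  ℕ→ℚ-mkℚ : ∀ k → ℕ→ℚ k ≡ mkℚ (+ k) 0 (Coprime.sym (1-coprimeTo k))
  ℕ→ℚ-mkℚ k = QP.normalize-coprime (Coprime.sym (1-coprimeTo k))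

  recip-mkℚ : ∀ k → recip (suc k) ≡ mkℚ (+ 1) k (1-coprimeTo (suc k))
  recip-mkℚ k = QP.normalize-coprime (1-coprimeTo (suc k))

  -- The embedding ℕ → ℚ is additive (checked on unnormalised representatives).
  ℕ→ℚ-+ : ∀ a b → ℕ→ℚ (a ℕ.+ b) ≡ ℕ→ℚ a + ℕ→ℚ b
  ℕ→ℚ-+ a b rewrite ℕ→ℚ-mkℚ (a ℕ.+ b) | ℕ→ℚ-mkℚ a | ℕ→ℚ-mkℚ b =
    QP.toℚᵘ-injective (UP.≃-trans (U.*≡* unnormalised) (UP.≃-sym (QP.toℚᵘ-homo-+ a/1 b/1)))
    where
    a/1 : ℚ
    a/1 = mkℚ (+ a) 0 (Coprime.sym (1-coprimeTo a))
    b/1 : ℚ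
    b/1 = mkℚ (+ b) 0 (Coprime.sym (1-coprimeTo b))
    open ≡-Reasoning
    unnormalised : + (a ℕ.+ b) ℤ.* (+ 1 ℤ.* + 1) ≡ (+ a ℤ.* + 1 ℤ.+ + b ℤ.* + 1) ℤ.* + 1
    unnormalised = begin
      + (a ℕ.+ b) ℤ.* + 1                    ≡⟨ ℤP.*-identityʳ _ ⟩
      + (a ℕ.+ b)                            ≡⟨ ℤP.pos-+ a b ⟩
      + a ℤ.+ + b                            ≡⟨ cong₂ ℤ._+_ (ℤP.*-identityʳ (+ a)) (ℤP.*-identityʳ (+ b)) ⟨
      + a ℤ.* + 1 ℤ.+ + b ℤ.* + 1            ≡⟨ ℤP.*-identityʳ _ ⟨
      (+ a ℤ.* + 1 ℤ.+ + b ℤ.* + 1) ℤ.* + 1  ∎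

  ℕ→ℚ-suc : ∀ k → ℕ→ℚ (suc k) ≡ 1ℚ + ℕ→ℚ k
  ℕ→ℚ-suc = ℕ→ℚ-+ 1

  ℕ→ℚ-nonneg : ∀ k → 0ℚ ≤ ℕ→ℚ k
  ℕ→ℚ-nonneg k rewrite ℕ→ℚ-mkℚ k = QP.nonNegative⁻¹ _

  ℕ→ℚ-mono : ∀ {a b} → a ℕ.≤ b → ℕ→ℚ a ≤ ℕ→ℚ b
  ℕ→ℚ-mono {a} a≤b with ℕP.m≤n⇒∃[o]m+o≡n a≤b
  ... | c , refl rewrite ℕ→ℚ-+ a c =
    QP.≤-trans (QP.≤-reflexive (sym (QP.+-identityʳ (ℕ→ℚ a)))) (QP.+-monoʳ-≤ (ℕ→ℚ a) (ℕ→ℚ-nonneg c))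

  recip-nonneg : ∀ k → 0ℚ ≤ recip k
  recip-nonneg zero = QP.≤-refl
  recip-nonneg (suc k) rewrite recip-mkℚ k = QP.nonNegative⁻¹ _

  recip-inverse : ∀ k → recip (suc k) * ℕ→ℚ (suc k) ≡ 1ℚ
  recip-inverse k rewrite recip-mkℚ k | ℕ→ℚ-mkℚ (suc k) =
    QP.*-inverseˡ (mkℚ (+ suc k) 0 (Coprime.sym (1-coprimeTo (suc k))))

  0≤+ : ∀ {a b} → 0ℚ ≤ a → 0ℚ ≤ b → 0ℚ ≤ a + b
  0≤+ p q = QP.≤-trans (QP.≤-reflexive (sym (QP.+-identityʳ 0ℚ))) (QP.+-mono-≤ p q)

  Σ-cong : ∀ k {f g : ℕ → ℚ} → (∀ i → i < k → f i ≡ g i) → Σ< k f ≡ Σ< k g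
  Σ-cong zero eq = refl
  Σ-cong (suc k) eq = cong₂ _+_ (Σ-cong k (λ i i<k → eq i (ℕP.m<n⇒m<1+n i<k))) (eq k ℕP.≤-refl)

  Σ-cong′ : ∀ k {f g : ℕ → ℚ} → (∀ i → f i ≡ g i) → Σ< k f ≡ Σ< k g
  Σ-cong′ k eq = Σ-cong k (λ i _ → eq i)

  Σ-mono : ∀ k {f g : ℕ → ℚ} → (∀ i → i < k → f i ≤ g i) → Σ< k f ≤ Σ< k g
  Σ-mono zero le = QP.≤-refl
  Σ-mono (suc k) le = QP.+-mono-≤ (Σ-mono k (λ i i<k → le i (ℕP.m<n⇒m<1+n i<k))) (le k ℕP.≤-refl)

  Σ-zero : ∀ k {f : ℕ → ℚ} → (∀ i → i < k → f i ≡ 0ℚ) → Σ< k f ≡ 0ℚ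
  Σ-zero zero eq = refl
  Σ-zero (suc k) eq
    rewrite Σ-zero k (λ i i<k → eq i (ℕP.m<n⇒m<1+n i<k)) | eq k ℕP.≤-refl = refl

  Σ-nonneg : ∀ k (f : ℕ → ℚ) → (∀ i → 0ℚ ≤ f i) → 0ℚ ≤ Σ< k f
  Σ-nonneg zero f nn = QP.≤-refl
  Σ-nonneg (suc k) f nn = 0≤+ (Σ-nonneg k f nn) (nn k)

  Σ-+ : ∀ k (f g : ℕ → ℚ) → Σ< k (λ i → f i + g i) ≡ Σ< k f + Σ< k g
  Σ-+ zero f g = refl
  Σ-+ (suc k) f g rewrite Σ-+ k f g =
    solve 4 (λ a b c d → (a :+ b) :+ (c :+ d) := (a :+ c) :+ (b :+ d)) refl (Σ< k f) (Σ< k g) (f k) (g k)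

  Σ-neg : ∀ k (f : ℕ → ℚ) → Σ< k (λ i → - f i) ≡ - Σ< k f
  Σ-neg zero f = refl
  Σ-neg (suc k) f rewrite Σ-neg k f = sym (QP.neg-distrib-+ (Σ< k f) (f k))

  Σ-scale : ∀ k c (f : ℕ → ℚ) → c * Σ< k f ≡ Σ< k (λ i → c * f i)
  Σ-scale zero c f = QP.*-zeroʳ c
  Σ-scale (suc k) c f rewrite sym (Σ-scale k c f) = QP.*-distribˡ-+ c _ _

  Σ-const : ∀ k c → Σ< k (λ _ → c) ≡ ℕ→ℚ k * c
  Σ-const zero c = sym (QP.*-zeroˡ c)
  Σ-const (suc k) c rewrite Σ-const k c | ℕ→ℚ-suc k =
    solve 2 (λ x c → x :* c :+ c := (con 1ℚ :+ x) :* c) refl (ℕ→ℚ k) c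

  Σ-split : ∀ a b (f : ℕ → ℚ) → Σ< (a ℕ.+ b) f ≡ Σ< a f + Σ< b (λ i → f (a ℕ.+ i))
  Σ-split a zero f rewrite ℕP.+-identityʳ a = sym (QP.+-identityʳ (Σ< a f))
  Σ-split a (suc b) f rewrite ℕP.+-suc a b | Σ-split a b f =
    QP.+-assoc (Σ< a f) (Σ< b (λ i → f (a ℕ.+ i))) (f (a ℕ.+ b))

  Σ-head : ∀ k (f : ℕ → ℚ) → Σ< (suc k) f ≡ f 0 + Σ< k (λ i → f (suc i))
  Σ-head zero f = trans (QP.+-identityˡ (f 0)) (sym (QP.+-identityʳ (f 0)))
  Σ-head (suc k) f rewrite Σ-head k f = QP.+-assoc (f 0) (Σ< k (λ i → f (suc i))) (f (suc k))

  Σ-swap : ∀ a b (f : ℕ → ℕ → ℚ) → Σ< a (λ i → Σ< b (f i)) ≡ Σ< b (λ j → Σ< a (λ i → f i j))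
  Σ-swap zero b f = sym (Σ-zero b (λ _ _ → refl))
  Σ-swap (suc a) b f rewrite Σ-swap a b f = sym (Σ-+ b (λ j → Σ< a (λ i → f i j)) (f a))

  Σ-rotate : ∀ P (g : ℕ → ℚ) → (∀ x → g (x ℕ.+ P) ≡ g x) →
             ∀ m → Σ< P (λ s → g (s ℕ.+ m)) ≡ Σ< P g
  Σ-rotate P g per zero = Σ-cong′ P (λ i → cong g (ℕP.+-identityʳ i))
  Σ-rotate P g per (suc m) = begin
      Σ< P (λ s → g (s ℕ.+ suc m))
    ≡⟨ Σ-cong′ P (λ s → cong g (ℕP.+-suc s m)) ⟩
      Σ< P (λ s → g (suc s ℕ.+ m))
    ≡⟨ solve 2 (λ x y → x := (y :+ x) :- y) refl (Σ< P (λ s → g (suc s ℕ.+ m))) (g m) ⟩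
      (g m + Σ< P (λ s → g (suc s ℕ.+ m))) - g m
    ≡⟨ cong (_- g m) (sym (Σ-head P (λ s → g (s ℕ.+ m)))) ⟩
      (Σ< P (λ s → g (s ℕ.+ m)) + g (P ℕ.+ m)) - g m
    ≡⟨ cong (λ z → (Σ< P (λ s → g (s ℕ.+ m)) + z) - g m) (trans (cong g (ℕP.+-comm P m)) (per m)) ⟩
      (Σ< P (λ s → g (s ℕ.+ m)) + g m) - g m
    ≡⟨ solve 2 (λ a b → (a :+ b) :- b := a) refl (Σ< P (λ s → g (s ℕ.+ m))) (g m) ⟩
      Σ< P (λ s → g (s ℕ.+ m))
    ≡⟨ Σ-rotate P g per m ⟩
      Σ< P g ∎
    where open ≡-Reasoning

module Walks where
  open Sums
  open import Data.Nat as ℕ using (ℕ; zero; suc; _<_; s≤s; z≤n)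
  import Data.Nat.Properties as ℕP
  open import Data.List using (applyUpTo)
  open import Data.Product using (_×_; _,_; proj₁; proj₂)
  open import Data.Rational using (ℚ; 0ℚ; 1ℚ; _+_; _*_; _-_)
  import Data.Rational.Properties as QP
  open import Data.Rational.Solver using (module +-*-Solver)
  open import Relation.Binary.PropositionalEquality
    using (_≡_; refl; sym; cong; cong₂; trans; subst; module ≡-Reasoning)
  open +-*-Solver

  Periodic : ℕ → (ℕ → ℕ) → Set
  Periodic p G = ∀ x → G (x ℕ.+ p) ≡ G x

  AwayThenHome : ℕ → ℕ → ℕ → (ℕ → ℕ) → (ℕ → ℕ) → Set
  AwayThenHome N t st G a =
    (∀ j → j < N → G (j ℕ.+ st) ≡ a j) × (∀ j → N ℕ.≤ j → j < N ℕ.+ N → G (j ℕ.+ st) ≡ t)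

  lastOr-applyUpTo : ∀ m (f : ℕ → ℕ) → lastOr (f 0) (applyUpTo (λ i → f (suc i)) m) ≡ f m
  lastOr-applyUpTo zero f = refl
  lastOr-applyUpTo (suc m) f = lastOr-applyUpTo m (λ i → f (suc i))

  module ClosedWalks (D : ℕ → ℕ → ℚ) where

    pathLen-applyUpTo : ∀ m (f : ℕ → ℕ) → pathLen D (applyUpTo f (suc m)) ≡ Σ< m (λ i → D (f i) (f (suc i)))
    pathLen-applyUpTo zero f = refl
    pathLen-applyUpTo (suc m) f =
      trans (cong (D (f 0) (f 1) +_) (pathLen-applyUpTo m (λ i → f (suc i)))) (sym (Σ-head m (λ i → D (f i) (f (suc i)))))

    tourLength : (ℕ → ℕ) → ℕ → ℚ
    tourLength G p = Σ< p (λ s → D (G s) (G (suc s)))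

    starSum : ℕ → (ℕ → ℕ) → ℕ → ℚ
    starSum t G p = Σ< p (λ s → D t (G s))

    walkFrom : ℕ → (ℕ → ℕ) → ℕ → ℕ → ℚ
    walkFrom t G q m =
      D t (G m) + Σ< q (λ s → D (G (s ℕ.+ m)) (G (suc (s ℕ.+ m)))) + D (G (q ℕ.+ m)) t

    Σ-walkFrom : (∀ i j → D i j ≡ D j i) → ∀ q G → Periodic (suc q) G → ∀ t →
      Σ< (suc q) (walkFrom t G q) ≡ ℕ→ℚ q * tourLength G (suc q) + (starSum t G (suc q) + starSum t G (suc q))
    Σ-walkFrom D-sym q G per t = begin
        Σ< (suc q) (walkFrom t G q)
      ≡⟨ solve 2 (λ x c → x := (x :+ c) :- c) refl (Σ< (suc q) (walkFrom t G q)) C ⟩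
        (Σ< (suc q) (walkFrom t G q) + C) - C
      ≡⟨ cong (_- C) closeUp ⟩
        (A + ℕ→ℚ (suc q) * C + A) - C
      ≡⟨ cong (λ z → (A + z * C + A) - C) (ℕ→ℚ-suc q) ⟩
        (A + (1ℚ + ℕ→ℚ q) * C + A) - C
      ≡⟨ solve 3 (λ a q c → (a :+ (con 1ℚ :+ q) :* c :+ a) :- c := q :* c :+ (a :+ a)) refl A (ℕ→ℚ q) C ⟩
        ℕ→ℚ q * C + (A + A) ∎
      where
      open ≡-Reasoning
      step : ℕ → ℚ
      step y = D (G y) (G (suc y))
      step-per : ∀ x → step (x ℕ.+ suc q) ≡ step x
      step-per x = cong₂ D (per x) (per (suc x))
      C : ℚ
      C = tourLength G (suc q)
      A : ℚ
      A = starSum t G (suc q)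
      -- completing walk m by its missing step gives: home → G m, one full tour, G m → home
      completed : ∀ m → walkFrom t G q m + step (m ℕ.+ q) ≡ D t (G m) + C + D t (G (m ℕ.+ q))
      completed m = begin
          walkFrom t G q m + step (m ℕ.+ q)
        ≡⟨ cong (λ z → walkFrom t G q m + step z) (ℕP.+-comm m q) ⟩
          walkFrom t G q m + step (q ℕ.+ m)
        ≡⟨ solve 4 (λ a b c e → a :+ b :+ c :+ e := a :+ (b :+ e) :+ c) refl
             (D t (G m)) (Σ< q (λ s → step (s ℕ.+ m))) (D (G (q ℕ.+ m)) t) (step (q ℕ.+ m)) ⟩
          D t (G m) + Σ< (suc q) (λ s → step (s ℕ.+ m)) + D (G (q ℕ.+ m)) t
        ≡⟨ cong₂ (λ a b → D t (G m) + a + b) (Σ-rotate (suc q) step step-per m)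
                 (trans (D-sym _ _) (cong (λ z → D t (G z)) (ℕP.+-comm q m))) ⟩
          D t (G m) + C + D t (G (m ℕ.+ q)) ∎
      closeUp : Σ< (suc q) (walkFrom t G q) + C ≡ A + ℕ→ℚ (suc q) * C + A
      closeUp = begin
          Σ< (suc q) (walkFrom t G q) + C
        ≡⟨ cong (Σ< (suc q) (walkFrom t G q) +_) (sym (Σ-rotate (suc q) step step-per q)) ⟩
          Σ< (suc q) (walkFrom t G q) + Σ< (suc q) (λ m → step (m ℕ.+ q))
        ≡⟨ sym (Σ-+ (suc q) (walkFrom t G q) (λ m → step (m ℕ.+ q))) ⟩
          Σ< (suc q) (λ m → walkFrom t G q m + step (m ℕ.+ q))
        ≡⟨ Σ-cong′ (suc q) completed ⟩
          Σ< (suc q) (λ m → D t (G m) + C + D t (G (m ℕ.+ q)))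
        ≡⟨ Σ-+ (suc q) (λ m → D t (G m) + C) (λ m → D t (G (m ℕ.+ q))) ⟩
          Σ< (suc q) (λ m → D t (G m) + C) + Σ< (suc q) (λ m → D t (G (m ℕ.+ q)))
        ≡⟨ cong₂ _+_ (trans (Σ-+ (suc q) (λ m → D t (G m)) (λ _ → C)) (cong (A +_) (Σ-const (suc q) C)))
                     (Σ-rotate (suc q) (λ y → D t (G y)) (λ x → cong (D t) (per x)) q) ⟩
          A + ℕ→ℚ (suc q) * C + A ∎

    module _ (D-zero : ∀ i → D i i ≡ 0ℚ) (M t st : ℕ) (G a : ℕ → ℕ)
             (per : Periodic (suc M ℕ.+ suc M) G) (block : AwayThenHome (suc M) t st G a) where

      private
        N : ℕ
        N = suc M
        away : ∀ j → j < N → G (j ℕ.+ st) ≡ a j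
        away = proj₁ block
        home : ∀ j → N ℕ.≤ j → j < N ℕ.+ N → G (j ℕ.+ st) ≡ t
        home = proj₂ block
        step : ℕ → ℚ
        step y = D (G y) (G (suc y))

      tour-AwayThenHome :
        tourLength G (N ℕ.+ N) ≡ Σ< M (λ j → D (a j) (a (suc j))) + D (a M) t + D t (a 0)
      tour-AwayThenHome = begin
          Σ< (N ℕ.+ N) step
        ≡⟨ sym (Σ-rotate (N ℕ.+ N) step (λ x → cong₂ D (per x) (per (suc x))) st) ⟩
          Σ< (N ℕ.+ N) (λ s → step (s ℕ.+ st))
        ≡⟨ Σ-split N N (λ s → step (s ℕ.+ st)) ⟩
          Σ< N (λ s → step (s ℕ.+ st)) + Σ< N (λ i → step ((N ℕ.+ i) ℕ.+ st))
        ≡⟨ cong₂ _+_ (cong₂ _+_ awayPart lastAway) (cong₂ _+_ homePart backAway) ⟩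
          (Σ< M (λ j → D (a j) (a (suc j))) + D (a M) t) + (0ℚ + D t (a 0))
        ≡⟨ cong ((Σ< M (λ j → D (a j) (a (suc j))) + D (a M) t) +_) (QP.+-identityˡ _) ⟩
          Σ< M (λ j → D (a j) (a (suc j))) + D (a M) t + D t (a 0) ∎
        where
        open ≡-Reasoning
        awayPart : Σ< M (λ s → step (s ℕ.+ st)) ≡ Σ< M (λ j → D (a j) (a (suc j)))
        awayPart = Σ-cong M (λ j j<M → cong₂ D (away j (ℕP.m<n⇒m<1+n j<M)) (away (suc j) (s≤s j<M)))
        lastAway : step (M ℕ.+ st) ≡ D (a M) t
        lastAway = cong₂ D (away M ℕP.≤-refl) (home N ℕP.≤-refl (ℕP.m<m+n N (s≤s z≤n)))
        homePart : Σ< M (λ i → step ((N ℕ.+ i) ℕ.+ st)) ≡ 0ℚ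
        homePart = Σ-zero M (λ i i<M → trans
          (cong₂ D (home (N ℕ.+ i) (ℕP.m≤m+n N i) (ℕP.+-monoʳ-< N (ℕP.m<n⇒m<1+n i<M)))
                   (home (suc (N ℕ.+ i)) (ℕP.≤-trans (ℕP.m≤m+n N i) (ℕP.n≤1+n _))
                         (subst (_< N ℕ.+ N) (ℕP.+-suc N i) (ℕP.+-monoʳ-< N (s≤s i<M)))))
          (D-zero t))
        backAway : step ((N ℕ.+ M) ℕ.+ st) ≡ D t (a 0)
        backAway = cong₂ D (home (N ℕ.+ M) (ℕP.m≤m+n N M) (ℕP.+-monoʳ-< N ℕP.≤-refl))
          (begin
            G (suc (N ℕ.+ M ℕ.+ st)) ≡⟨ cong (λ z → G (z ℕ.+ st)) (sym (ℕP.+-suc N M)) ⟩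
            G (N ℕ.+ N ℕ.+ st)       ≡⟨ cong G (ℕP.+-comm (N ℕ.+ N) st) ⟩
            G (st ℕ.+ (N ℕ.+ N))     ≡⟨ per st ⟩
            G st                     ≡⟨ away 0 (s≤s z≤n) ⟩
            a 0                      ∎)

      -- home slots contribute nothing to the distances from home
      star-AwayThenHome : starSum t G (N ℕ.+ N) ≡ Σ< N (λ j → D t (a j))
      star-AwayThenHome = begin
          Σ< (N ℕ.+ N) (λ y → D t (G y))
        ≡⟨ sym (Σ-rotate (N ℕ.+ N) (λ y → D t (G y)) (λ x → cong (D t) (per x)) st) ⟩
          Σ< (N ℕ.+ N) (λ s → D t (G (s ℕ.+ st)))
        ≡⟨ Σ-split N N (λ s → D t (G (s ℕ.+ st))) ⟩
          Σ< N (λ s → D t (G (s ℕ.+ st))) + Σ< N (λ i → D t (G ((N ℕ.+ i) ℕ.+ st)))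
        ≡⟨ cong₂ _+_ (Σ-cong N (λ j j<N → cong (D t) (away j j<N)))
                     (Σ-zero N (λ i i<N → trans (cong (D t) (home (N ℕ.+ i) (ℕP.m≤m+n N i) (ℕP.+-monoʳ-< N i<N)))
                                                (D-zero t))) ⟩
          Σ< N (λ j → D t (a j)) + 0ℚ
        ≡⟨ QP.+-identityʳ _ ⟩
          Σ< N (λ j → D t (a j)) ∎
        where open ≡-Reasoning

module Metric {n : ℕ} (d : Fin n → Fin n → ℚ) (met : IsMetric d) where
  open Sums
  open import Data.Nat as ℕ using (ℕ; _<_)
  open import Data.Nat.Properties using (_<?_)
  open import Data.Empty using (⊥-elim)
  open import Data.Sum using (_⊎_; inj₁; inj₂)
  open import Data.Product using (_,_; proj₁; proj₂)
  open import Data.List using (List; []; _∷_)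
  open import Data.List.Relation.Unary.Any using (here; there)
  open import Data.List.Membership.Propositional using (_∈_)
  open import Data.List.Membership.Propositional.Properties using (∈-upTo⁺; ∈-upTo⁻)
  open import Data.List.Relation.Binary.Permutation.Propositional using (↭-sym)
  open import Data.List.Relation.Binary.Permutation.Propositional.Properties using (Any-resp-↭)
  open import Data.Rational using (ℚ; 0ℚ; ½; _+_; _*_; _≤_)
  import Data.Rational.Properties as QP
  open import Data.Rational.Solver using (module +-*-Solver)
  open import Relation.Nullary using (yes; no; ¬_; Dec)
  open import Relation.Binary.PropositionalEquality using (_≡_; refl; sym; cong₂; subst)
  open +-*-Solver

  D : ℕ → ℕ → ℚ
  D = dℕ d

  private
    D-outˡ : ∀ {i} j → ¬ (i < n) → D i j ≡ 0ℚ
    D-outˡ {i} j ¬p with i <? n | j <? n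
    ... | yes p | _     = ⊥-elim (¬p p)
    ... | no _  | yes _ = refl
    ... | no _  | no _  = refl

    D-outʳ : ∀ i {j} → ¬ (j < n) → D i j ≡ 0ℚ
    D-outʳ i {j} ¬q with i <? n | j <? n
    ... | _     | yes q = ⊥-elim (¬q q)
    ... | yes _ | no _  = refl
    ... | no _  | no _  = refl

  D-nonneg : ∀ i j → 0ℚ ≤ D i j
  D-nonneg i j with i <? n | j <? n
  ... | yes _ | yes _ = proj₁ met _ _
  ... | no _  | _     = QP.≤-refl
  ... | yes _ | no _  = QP.≤-refl

  D-sym : ∀ i j → D i j ≡ D j i
  D-sym i j with i <? n | j <? n
  ... | yes _ | yes _ = proj₁ (proj₂ (proj₂ met)) _ _
  ... | yes _ | no _  = refl
  ... | no _  | yes _ = refl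
  ... | no _  | no _  = refl

  D-zero : ∀ i → D i i ≡ 0ℚ
  D-zero i with i <? n
  ... | yes _ = proj₁ (proj₂ met) _
  ... | no _  = refl

  D-tri : ∀ i j k → j < n → D i k ≤ D i j + D j k
  D-tri i j k j<n with i <? n | j <? n | k <? n
  ... | yes _ | yes _  | yes _ = proj₂ (proj₂ (proj₂ met)) _ _ _
  ... | _     | no j≮n | _     = ⊥-elim (j≮n j<n)
  ... | no _  | yes _  | yes _ = 0≤+ QP.≤-refl (proj₁ met _ _)
  ... | no _  | yes _  | no _  = 0≤+ QP.≤-refl QP.≤-refl
  ... | yes _ | yes _  | no _  = 0≤+ (proj₁ met _ _) QP.≤-refl

  InRange : List ℕ → Set
  InRange L = ∀ y → y ∈ L → y < n

  path-shortcut : ∀ x xs → InRange (x ∷ xs) → D x (lastOr x xs) ≤ pathLen D (x ∷ xs)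
  path-shortcut x [] _ = QP.≤-reflexive (D-zero x)
  path-shortcut x (y ∷ ys) inr =
    QP.≤-trans (D-tri x y (lastOr y ys) (inr y (there (here refl))))
               (QP.+-monoʳ-≤ (D x y) (path-shortcut y ys (λ z z∈ → inr z (there z∈))))

  path-via : ∀ x xs y → InRange (x ∷ xs) → y ∈ x ∷ xs → D x y + D y (lastOr x xs) ≤ pathLen D (x ∷ xs)
  path-via x xs .x inr (here refl) rewrite D-zero x | QP.+-identityˡ (D x (lastOr x xs)) = path-shortcut x xs inr
  path-via x (z ∷ zs) y inr (there y∈) =
    QP.≤-trans (QP.≤-trans (QP.+-monoˡ-≤ (D y (lastOr z zs)) (D-tri x z y (inr z (there (here refl)))))
                           (QP.≤-reflexive (QP.+-assoc (D x z) (D z y) (D y (lastOr z zs)))))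
               (QP.+-monoʳ-≤ (D x z) (path-via z zs y (λ w w∈ → inr w (there w∈)) y∈))

  PassesThrough : ℕ → List ℕ → ℕ → ℕ → Set
  PassesThrough x xs u v = D x u + D u v + D v (lastOr x xs) ≤ pathLen D (x ∷ xs)

  passesThrough-cons : ∀ x z zs u v → z < n → PassesThrough z zs u v → PassesThrough x (z ∷ zs) u v
  passesThrough-cons x z zs u v z<n le =
    QP.≤-trans (QP.+-monoˡ-≤ (D v (lastOr z zs)) (QP.+-monoˡ-≤ (D u v) (D-tri x z u z<n)))
      (QP.≤-trans (QP.≤-reflexive (solve 4 (λ a b c e → a :+ b :+ c :+ e := a :+ (b :+ c :+ e)) refl
                                          (D x z) (D z u) (D u v) (D v (lastOr z zs))))
                  (QP.+-monoʳ-≤ (D x z) le))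

  passesThrough-both : ∀ x xs u v → InRange (x ∷ xs) → u ∈ x ∷ xs → v ∈ x ∷ xs →
                       PassesThrough x xs u v ⊎ PassesThrough x xs v u
  passesThrough-both x xs .x v inr (here refl) v∈
    rewrite D-zero x | QP.+-identityˡ (D x v) = inj₁ (path-via x xs v inr v∈)
  passesThrough-both x xs u .x inr (there u∈) (here refl)
    rewrite D-zero x | QP.+-identityˡ (D x u) = inj₂ (path-via x xs u inr (there u∈))
  passesThrough-both x (z ∷ zs) u v inr (there u∈) (there v∈)
    with passesThrough-both z zs u v (λ w w∈ → inr w (there w∈)) u∈ v∈
  ... | inj₁ le = inj₁ (passesThrough-cons x z zs u v (inr z (there (here refl))) le)
  ... | inj₂ le = inj₂ (passesThrough-cons x z zs v u (inr z (there (here refl))) le)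

  lastOr-∈ : ∀ x xs → lastOr x xs ∈ x ∷ xs
  lastOr-∈ x [] = here refl
  lastOr-∈ x (y ∷ ys) = there (lastOr-∈ y ys)

  -- closing the path: the cycle contains two disjoint u–v routes
  passesThrough⇒cycle : ∀ x xs u v → InRange (x ∷ xs) → PassesThrough x xs u v →
                        D u v + D u v ≤ cycLen D (x ∷ xs)
  passesThrough⇒cycle x xs u v inr le =
    QP.≤-trans (QP.+-monoʳ-≤ (D u v) backRoute)
      (QP.≤-trans (QP.≤-reflexive (solve 4 (λ a b c e → b :+ (c :+ e :+ a) := a :+ b :+ c :+ e) refl
                                          (D x u) (D u v) (D v l) (D l x)))
                  (QP.+-monoˡ-≤ (D l x) le))
    where
    l : ℕ
    l = lastOr x xs
    backRoute : D u v ≤ D v l + D l x + D x u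
    backRoute = QP.≤-trans (QP.≤-reflexive (D-sym u v))
      (QP.≤-trans (D-tri v l u (inr l (lastOr-∈ x xs)))
        (QP.≤-trans (QP.+-monoʳ-≤ (D v l) (D-tri l x u (inr x (here refl))))
                    (QP.≤-reflexive (sym (QP.+-assoc (D v l) (D l x) (D x u))))))

  cycle-double : ∀ L u v → InRange L → u ∈ L → v ∈ L → D u v + D u v ≤ cycLen D L
  cycle-double (x ∷ xs) u v inr u∈ v∈ with passesThrough-both x xs u v inr u∈ v∈
  ... | inj₁ le = passesThrough⇒cycle x xs u v inr le
  ... | inj₂ le = subst (_≤ cycLen D (x ∷ xs)) (cong₂ _+_ (D-sym v u) (D-sym v u))
                        (passesThrough⇒cycle x xs v u inr le)

  path-nonneg : ∀ L → 0ℚ ≤ pathLen D L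
  path-nonneg [] = QP.≤-refl
  path-nonneg (x ∷ []) = QP.≤-refl
  path-nonneg (x ∷ y ∷ ys) = 0≤+ (D-nonneg x y) (path-nonneg (y ∷ ys))

  cycle-nonneg : ∀ L → 0ℚ ≤ cycLen D L
  cycle-nonneg [] = QP.≤-refl
  cycle-nonneg (x ∷ xs) = 0≤+ (path-nonneg (x ∷ xs)) (D-nonneg _ _)

  D≤½τ : ∀ τ → IsShortestHamCycleLength d τ → ∀ u v → D u v ≤ ½ * τ
  D≤½τ τ ((π , π↭ , len≡τ) , _) u v =
    QP.≤-trans (QP.≤-reflexive (solve 1 (λ x → x := con ½ :* (x :+ x)) refl (D u v)))
               (QP.*-monoˡ-≤-nonNeg ½ doubled)
    where
    inRange : InRange π
    inRange y y∈ = ∈-upTo⁻ (Any-resp-↭ π↭ y∈)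
    τ-nonneg : 0ℚ ≤ τ
    τ-nonneg = subst (0ℚ ≤_) len≡τ (cycle-nonneg π)
    doubled : D u v + D u v ≤ τ
    doubled = byRange (u <? n) (v <? n)
      where
      byRange : Dec (u < n) → Dec (v < n) → D u v + D u v ≤ τ
      byRange (yes p) (yes q) = subst (D u v + D u v ≤_) len≡τ
        (cycle-double π u v inRange (Any-resp-↭ (↭-sym π↭) (∈-upTo⁺ p)) (Any-resp-↭ (↭-sym π↭) (∈-upTo⁺ q)))
      byRange (no ¬p) _       rewrite D-outˡ v ¬p = τ-nonneg
      byRange (yes _) (no ¬q) rewrite D-outʳ u ¬q = τ-nonneg

module Schedule where
  open Walks using (Periodic; AwayThenHome)
  open import Data.Nat using (ℕ; zero; suc; _+_; _*_; _∸_; _<_; _≤_; z≤n; s≤s; _≤ᵇ_; _<ᵇ_; _≡ᵇ_; _≤?_; _<?_)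
  import Data.Nat.Properties as ℕP
  open import Data.Nat.Properties using (_≟_)
  open import Data.Nat.DivMod
  open import Data.Nat.Divisibility using (divides)
  open import Data.Nat.Solver using (module +-*-Solver)
  open import Data.Bool using (Bool; true; false; if_then_else_; _∧_; not)
  open import Data.Bool.Properties using (∧-zeroʳ)
  open import Data.Empty using (⊥; ⊥-elim)
  open import Data.Sum using (_⊎_; inj₁; inj₂)
  open import Data.Product using (_,_)
  open import Relation.Nullary using (Dec; yes; no; does; ¬_)
  open import Relation.Binary.PropositionalEquality
  open +-*-Solver using (solve; _:+_; _:*_; _:=_; con)

  if-true : ∀ {A : Set} {b : Bool} {x y : A} → b ≡ true → (if b then x else y) ≡ x
  if-true refl = refl

  if-false : ∀ {A : Set} {b : Bool} {x y : A} → b ≡ false → (if b then x else y) ≡ y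
  if-false refl = refl

  does-true : ∀ {P : Set} (P? : Dec P) → P → does P? ≡ true
  does-true (yes _) _ = refl
  does-true (no ¬p) p = ⊥-elim (¬p p)

  does-false : ∀ {P : Set} (P? : Dec P) → ¬ P → does P? ≡ false
  does-false (yes p) ¬p = ⊥-elim (¬p p)
  does-false (no _) _ = refl

  ≤ᵇ-true : ∀ {a b} → a ≤ b → (a ≤ᵇ b) ≡ true
  ≤ᵇ-true {a} {b} = does-true (a ≤? b)

  ≤ᵇ-false : ∀ {a b} → b < a → (a ≤ᵇ b) ≡ false
  ≤ᵇ-false {a} {b} b<a = does-false (a ≤? b) (ℕP.<⇒≱ b<a)

  <ᵇ-true : ∀ {a b} → a < b → (a <ᵇ b) ≡ true
  <ᵇ-true {a} {b} = does-true (a <? b)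

  <ᵇ-false : ∀ {a b} → b ≤ a → (a <ᵇ b) ≡ false
  <ᵇ-false {a} {b} b≤a = does-false (a <? b) (ℕP.≤⇒≯ b≤a)

  ≡ᵇ-true : ∀ {a b} → a ≡ b → (a ≡ᵇ b) ≡ true
  ≡ᵇ-true {a} {b} = does-true (a ≟ b)

  ≡ᵇ-false : ∀ {a b} → a ≢ b → (a ≡ᵇ b) ≡ false
  ≡ᵇ-false {a} {b} = does-false (a ≟ b)

  module KStar (k : ℕ) where

    h : ℕ
    h = suc k
    n : ℕ
    n = suc (suc (h + h))
    N : ℕ
    N = suc (h + h)
    P : ℕ
    P = N + N

    slots≡P : 2 * n ∸ 2 ≡ P
    slots≡P = trans (cong ((h + h) +_) (ℕP.+-identityʳ n)) (ℕP.+-suc (h + h) N)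

    n/2≡ : n / 2 ≡ suc h
    n/2≡ = trans (cong (_/ 2) (solve 1 (λ h → con 2 :+ (h :+ h) := (con 1 :+ h) :* con 2) refl h))
                 (m*n/n≡m (suc h) 2)

    baseVenue : ℕ → ℕ → ℕ
    baseVenue t σ = if isHome n t σ then t else Kstar n t (σ % N)

    -- … and in slot x (mod P); slot s of K*_DRR(m) is slot s + m of K*_DRR
    venue : ℕ → ℕ → ℕ
    venue t x = baseVenue t (modN x (2 * n ∸ 2))

    venue-% : ∀ t x → venue t x ≡ baseVenue t (x % P)
    venue-% t x = cong (λ p → baseVenue t (modN x p)) slots≡P

    venue-periodic : ∀ t → Periodic P (venue t)
    venue-periodic t x = trans (venue-% t (x + P)) (trans (cong (baseVenue t) ([m+n]%n≡m%n x P)) (sym (venue-% t x)))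

    isHome-low : ∀ t σ → t ≤ h → isHome n t σ ≡ ((2 * t ≤ᵇ σ) ∧ (σ ≤ᵇ (h + h) + 2 * t))
    isHome-low t σ t≤h = trans (if-false (≡ᵇ-false t≢N)) (if-true (<ᵇ-true (subst (t <_) (sym n/2≡) (s≤s t≤h))))
      where
      t≢N : t ≢ N
      t≢N = ℕP.<⇒≢ (s≤s (ℕP.≤-trans t≤h (ℕP.m≤m+n h h)))

    isHome-high : ∀ t σ → h < t → t < N → isHome n t σ ≡ not (((2 * t + 2) ∸ n ≤ᵇ σ) ∧ (σ ≤ᵇ 2 * t))
    isHome-high t σ h<t t<N = trans (if-false (≡ᵇ-false (ℕP.<⇒≢ t<N))) (if-false (<ᵇ-false (subst (_≤ t) (sym n/2≡) h<t)))

    isHome-last : ∀ σ → isHome n N σ ≡ not (σ ≤ᵇ (h + h))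
    isHome-last σ = if-true (≡ᵇ-true {N} refl)

    -- away games of a team t < N follow the circle method: in slot x it meets x - t (mod N),
    -- except that the slot where this would be t itself is its game against N
    Kstar-circle : ∀ t x → t < N → Kstar n t (x % P % N) ≡ (if (x + (N ∸ t)) % N ≡ᵇ t then N else (x + (N ∸ t)) % N)
    Kstar-circle t x t<N =
      trans (if-false (≡ᵇ-false (ℕP.<⇒≢ t<N))) (cong (λ a → if a ≡ᵇ t then N else a) circle)
      where
      open ≡-Reasoning
      circle : ((x % P % N) + N ∸ t) % N ≡ (x + (N ∸ t)) % N
      circle = begin
          ((x % P % N) + N ∸ t) % N
        ≡⟨ cong (_% N) (ℕP.+-∸-assoc (x % P % N) (ℕP.<⇒≤ t<N)) ⟩
          ((x % P % N) + (N ∸ t)) % N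
        ≡⟨ %-distribˡ-+ (x % P % N) (N ∸ t) N ⟩
          ((x % P % N) % N + (N ∸ t) % N) % N
        ≡⟨ cong (λ z → (z + (N ∸ t) % N) % N)
                (trans (m%n%n≡m%n (x % P) N) (m∣n⇒o%n%m≡o%m N P x (divides 2 (solve 1 (λ M → M :+ M := con 2 :* M) refl N)))) ⟩
          (x % N + (N ∸ t) % N) % N
        ≡⟨ sym (%-distribˡ-+ x (N ∸ t) N) ⟩
          (x + (N ∸ t)) % N ∎

    rotation-moves : ∀ t y → 0 < y → y < N → (y + t) % N ≢ t
    rotation-moves t y 0<y y<N eq = multiple ((y + t) / N) y≡
      where
      y≡ : y ≡ (y + t) / N * N
      y≡ = ℕP.+-cancelʳ-≡ t y ((y + t) / N * N)
             (trans (m≡m%n+[m/n]*n (y + t) N) (trans (cong (_+ (y + t) / N * N) eq) (ℕP.+-comm t _)))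
      multiple : ∀ q → y ≡ q * N → ⊥
      multiple zero refl = ℕP.<-irrefl refl 0<y
      multiple (suc q) refl = ℕP.<-irrefl refl (ℕP.<-≤-trans y<N (ℕP.m≤m+n N (q * N)))

    %P-below : ∀ x → x < P → x % P ≡ x
    %P-below x = m<n⇒m%n≡m

    %P-wrap : ∀ r → r < P → (P + r) % P ≡ r
    %P-wrap r r<P = trans (cong (_% P) (ℕP.+-comm P r)) (trans ([m+n]%n≡m%n r P) (%P-below r r<P))

    outside-window : ∀ a x → a ≤ P → a + N ≤ x → x < P + a → (x % P < a) ⊎ (a + N ≤ x % P)
    outside-window a x a≤P a+N≤x x<P+a with x <? P
    ... | yes x<P = inj₂ (subst (a + N ≤_) (sym (%P-below x x<P)) a+N≤x)
    ... | no x≮P with ℕP.m≤n⇒∃[o]m+o≡n (ℕP.≮⇒≥ x≮P)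
    ...   | r , refl = inj₁ (subst (_< a) (sym (%P-wrap r (ℕP.<-≤-trans r<a a≤P))) r<a)
      where
      r<a : r < a
      r<a = ℕP.+-cancelˡ-< P r a x<P+a

    2*≡+ : ∀ t → 2 * t ≡ t + t
    2*≡+ t = cong (t +_) (ℕP.+-identityʳ t)

    lowTrip : ℕ → ℕ → ℕ
    lowTrip t zero = N
    lowTrip t (suc i) = (suc i + t) % N

    lowStart : ℕ → ℕ
    lowStart t = (t + t) + N

    low-awayThenHome : ∀ t → t ≤ h → AwayThenHome N t (lowStart t) (venue t) (lowTrip t)
    low-awayThenHome t t≤h = away , home
      where
      t<N : t < N
      t<N = s≤s (ℕP.≤-trans t≤h (ℕP.m≤m+n h h))
      t+t≤h+h : t + t ≤ h + h
      t+t≤h+h = ℕP.+-mono-≤ t≤h t≤h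

      away : ∀ j → j < N → venue t (j + lowStart t) ≡ lowTrip t j
      away j j<N = begin
          venue t x
        ≡⟨ venue-% t x ⟩
          baseVenue t (x % P)
        ≡⟨ if-false awaySlot ⟩
          Kstar n t (x % P % N)
        ≡⟨ Kstar-circle t x t<N ⟩
          (if (x + (N ∸ t)) % N ≡ᵇ t then N else (x + (N ∸ t)) % N)
        ≡⟨ cong (λ a → if a ≡ᵇ t then N else a) opponent≡ ⟩
          (if (j + t) % N ≡ᵇ t then N else (j + t) % N)
        ≡⟨ trip j j<N ⟩
          lowTrip t j ∎
        where
        open ≡-Reasoning
        x : ℕ
        x = j + lowStart t
        awaySlot : isHome n t (x % P) ≡ false
        awaySlot with outside-window (t + t) x (ℕP.≤-trans t+t≤h+h (ℕP.≤-trans (ℕP.n≤1+n (h + h)) (ℕP.m≤m+n N N)))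
                        (ℕP.m≤n+m (t + t + N) j)
                        (subst (x <_) (solve 2 (λ t M → M :+ (t :+ t :+ M) := M :+ M :+ (t :+ t)) refl t N)
                               (ℕP.+-monoˡ-< (t + t + N) j<N))
        ... | inj₁ σ<2t = trans (isHome-low t (x % P) t≤h)
                                (cong (_∧ ((x % P) ≤ᵇ (h + h) + 2 * t)) (≤ᵇ-false (subst (x % P <_) (sym (2*≡+ t)) σ<2t)))
        ... | inj₂ ge = trans (isHome-low t (x % P) t≤h) (trans (cong ((2 * t ≤ᵇ x % P) ∧_) (≤ᵇ-false late)) (∧-zeroʳ _))
          where
          late : (h + h) + 2 * t < x % P
          late = ℕP.<-≤-trans (subst (λ z → (h + h) + z < t + t + N) (sym (2*≡+ t))
                   (subst ((h + h) + (t + t) <_) (ℕP.+-comm N (t + t)) (ℕP.+-monoˡ-< (t + t) (ℕP.n<1+n (h + h))))) ge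
        opponent≡ : (x + (N ∸ t)) % N ≡ (j + t) % N
        opponent≡ = trans (cong (_% N) x+N-t≡) ([m+kn]%n≡m%n (j + t) 2 N)
          where
          x+N-t≡ : x + (N ∸ t) ≡ (j + t) + 2 * N
          x+N-t≡ = trans (solve 4 (λ j t c M → j :+ (t :+ t :+ M) :+ c := j :+ t :+ (t :+ c) :+ M) refl j t (N ∸ t) N)
                     (trans (cong (λ z → j + t + z + N) (ℕP.m+[n∸m]≡n (ℕP.<⇒≤ t<N)))
                            (solve 3 (λ j t M → j :+ t :+ M :+ M := j :+ t :+ con 2 :* M) refl j t N))
        trip : ∀ j → j < N → (if (j + t) % N ≡ᵇ t then N else (j + t) % N) ≡ lowTrip t j
        trip zero _ = if-true (≡ᵇ-true (m<n⇒m%n≡m t<N))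
        trip (suc i) si<N = if-false (≡ᵇ-false (rotation-moves t (suc i) (s≤s z≤n) si<N))

      home : ∀ j → N ≤ j → j < N + N → venue t (j + lowStart t) ≡ t
      home j N≤j j<P with ℕP.m≤n⇒∃[o]m+o≡n N≤j
      ... | r , refl = trans (venue-% t x) (if-true homeSlot)
        where
        x : ℕ
        x = (N + r) + lowStart t
        r<N : r < N
        r<N = ℕP.+-cancelˡ-< N r N j<P
        σ≡ : x % P ≡ r + (t + t)
        σ≡ = trans (cong (_% P) (solve 3 (λ r t M → M :+ r :+ (t :+ t :+ M) := M :+ M :+ (r :+ (t :+ t))) refl r t N))
                   (%P-wrap (r + (t + t)) (ℕP.+-mono-< r<N (s≤s t+t≤h+h)))
        homeSlot : isHome n t (x % P) ≡ true
        homeSlot rewrite isHome-low t (x % P) t≤h | σ≡ | 2*≡+ t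
          | ≤ᵇ-true {t + t} {r + (t + t)} (ℕP.m≤n+m (t + t) r)
          | ≤ᵇ-true {r + (t + t)} {h + h + (t + t)} (ℕP.+-monoˡ-≤ (t + t) (ℕP.≤-pred r<N)) = refl

    highTrip : ℕ → ℕ → ℕ
    highTrip t j = if j <ᵇ (h + h) then (suc j + t) % N else N

    highStart : ℕ → ℕ
    highStart u = suc (suc (u + u))

    high-awayThenHome : ∀ u → u < h → AwayThenHome N (suc h + u) (highStart u) (venue (suc h + u)) (highTrip (suc h + u))
    high-awayThenHome u u<h = away , home
      where
      t : ℕ
      t = suc h + u
      t<N : t < N
      t<N = s≤s (ℕP.+-monoʳ-< h u<h)
      h<t : h < t
      h<t = s≤s (ℕP.m≤m+n h u)
      start≤N : highStart u ≤ N
      start≤N = s≤s (ℕP.+-mono-< u<h u<h)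
      firstAway≡ : (2 * t + 2) ∸ n ≡ highStart u
      firstAway≡ = trans (cong (_∸ n) (solve 2 (λ h u → con 2 :* (con 1 :+ h :+ u) :+ con 2
                                                  := (con 2 :+ (h :+ h)) :+ (con 2 :+ (u :+ u))) refl h u))
                         (ℕP.m+n∸m≡n n (highStart u))
      lastAway≡ : 2 * t ≡ (h + h) + highStart u
      lastAway≡ = solve 2 (λ h u → con 2 :* (con 1 :+ h :+ u) := (h :+ h) :+ (con 2 :+ (u :+ u))) refl h u

      away : ∀ j → j < N → venue t (j + highStart u) ≡ highTrip t j
      away j j<N = begin
          venue t x
        ≡⟨ venue-% t x ⟩
          baseVenue t (x % P)
        ≡⟨ if-false awaySlot ⟩
          Kstar n t (x % P % N)
        ≡⟨ Kstar-circle t x t<N ⟩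
          (if (x + (N ∸ t)) % N ≡ᵇ t then N else (x + (N ∸ t)) % N)
        ≡⟨ cong (λ a → if (a % N) ≡ᵇ t then N else (a % N)) x+N-t≡ ⟩
          (if (suc j + t) % N ≡ᵇ t then N else (suc j + t) % N)
        ≡⟨ trip ⟩
          highTrip t j ∎
        where
        open ≡-Reasoning
        x : ℕ
        x = j + highStart u
        j≤ : j ≤ h + h
        j≤ = ℕP.≤-pred j<N
        x<P : x < P
        x<P = ℕP.≤-<-trans (ℕP.+-mono-≤ j≤ start≤N) (ℕP.+-monoˡ-< N (ℕP.n<1+n (h + h)))
        awaySlot : isHome n t (x % P) ≡ false
        awaySlot rewrite isHome-high t (x % P) h<t t<N | %P-below x x<P | firstAway≡
          | ≤ᵇ-true {highStart u} {x} (ℕP.m≤n+m (highStart u) j)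
          | ≤ᵇ-true {x} {2 * t} (subst (x ≤_) (sym lastAway≡) (ℕP.+-monoˡ-≤ (highStart u) j≤)) = refl
        x+N-t≡ : x + (N ∸ t) ≡ suc j + t
        x+N-t≡ = ℕP.+-cancelʳ-≡ t (x + (N ∸ t)) (suc j + t)
                (trans (ℕP.+-assoc x (N ∸ t) t)
                  (trans (cong (x +_) (trans (ℕP.+-comm (N ∸ t) t) (ℕP.m+[n∸m]≡n (ℕP.<⇒≤ t<N))))
                  (solve 3 (λ j h u → j :+ (con 2 :+ (u :+ u)) :+ (con 1 :+ (h :+ h))
                                      := (con 1 :+ j) :+ (con 1 :+ h :+ u) :+ (con 1 :+ h :+ u)) refl j h u)))
        trip : (if (suc j + t) % N ≡ᵇ t then N else (suc j + t) % N) ≡ highTrip t j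
        trip with j <? (h + h)
        ... | yes j<2h = trans (if-false (≡ᵇ-false (rotation-moves t (suc j) (s≤s z≤n) (s≤s j<2h))))
                               (sym (if-true (<ᵇ-true j<2h)))
        ... | no j≮2h with ℕP.≤-antisym j≤ (ℕP.≮⇒≥ j≮2h)
        ...   | refl = trans (if-true (≡ᵇ-true (trans ([m+n]%n≡m%n′ t) (m<n⇒m%n≡m t<N))))
                             (sym (if-false (<ᵇ-false (ℕP.≤-refl {h + h}))))
          where
          [m+n]%n≡m%n′ : ∀ t → (N + t) % N ≡ t % N
          [m+n]%n≡m%n′ t = trans (cong (_% N) (ℕP.+-comm N t)) ([m+n]%n≡m%n t N)

      home : ∀ j → N ≤ j → j < N + N → venue t (j + highStart u) ≡ t
      home j N≤j j<P = trans (venue-% t x) (if-true homeSlot)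
        where
        x : ℕ
        x = j + highStart u
        homeSlot : isHome n t (x % P) ≡ true
        homeSlot with outside-window (highStart u) x (ℕP.≤-trans start≤N (ℕP.m≤m+n N N))
                        (subst (_≤ x) (ℕP.+-comm N (highStart u)) (ℕP.+-monoˡ-≤ (highStart u) N≤j))
                        (ℕP.+-monoˡ-< (highStart u) j<P)
        ... | inj₁ σ<start rewrite isHome-high t (x % P) h<t t<N | firstAway≡ | ≤ᵇ-false {highStart u} {x % P} σ<start = refl
        ... | inj₂ ge rewrite isHome-high t (x % P) h<t t<N | firstAway≡ | lastAway≡
                | ≤ᵇ-false {x % P} {h + h + highStart u}
                    (ℕP.<-≤-trans (ℕP.+-monoˡ-< (highStart u) (ℕP.n<1+n (h + h)))
                                  (subst (_≤ x % P) (ℕP.+-comm (highStart u) N) ge))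
                = cong not (∧-zeroʳ _)

    last-awayThenHome : AwayThenHome N N 0 (venue N) (Kstar n N)
    last-awayThenHome = away , home
      where
      away : ∀ j → j < N → venue N (j + 0) ≡ Kstar n N j
      away j j<N rewrite ℕP.+-identityʳ j =
        trans (venue-% N j) (trans (cong (baseVenue N) (%P-below j (ℕP.<-≤-trans j<N (ℕP.m≤m+n N N))))
          (trans (if-false (trans (isHome-last j) (cong not (≤ᵇ-true (ℕP.≤-pred j<N))))) (cong (Kstar n N) (m<n⇒m%n≡m j<N))))
      home : ∀ j → N ≤ j → j < N + N → venue N (j + 0) ≡ N
      home j N≤j j<P rewrite ℕP.+-identityʳ j =
        trans (venue-% N j) (trans (cong (baseVenue N) (%P-below j j<P)) (if-true (trans (isHome-last j) (cong not (≤ᵇ-false N≤j)))))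

    Kstar-last-even : ∀ i → Kstar n N (i + i) ≡ i
    Kstar-last-even i = trans (if-true (≡ᵇ-true {N} refl))
      (trans (if-true (≡ᵇ-true (trans (cong (_% 2) i+i≡) (m*n%n≡0 i 2)))) (trans (cong (_/ 2) i+i≡) (m*n/n≡m i 2)))
      where
      i+i≡ : i + i ≡ i * 2
      i+i≡ = solve 1 (λ i → i :+ i := i :* con 2) refl i

    Kstar-last-odd : ∀ i → Kstar n N (suc (i + i)) ≡ suc h + i
    Kstar-last-odd i = trans (if-true (≡ᵇ-true {N} refl))
      (trans (if-false (≡ᵇ-false odd)) (trans (cong (_/ 2) sum≡) (m*n/n≡m (suc h + i) 2)))
      where
      sum≡ : suc (i + i) + N ≡ (suc h + i) * 2
      sum≡ = solve 2 (λ i h → con 1 :+ (i :+ i) :+ (con 1 :+ (h :+ h)) := (con 1 :+ h :+ i) :* con 2) refl i h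
      odd : suc (i + i) % 2 ≢ 0
      odd eq with trans (sym ([m+kn]%n≡m%n 1 i 2))
                        (trans (cong (_% 2) (solve 1 (λ i → con 1 :+ i :* con 2 := con 1 :+ (i :+ i)) refl i)) eq)
      ... | ()

open Schedule using (module KStar)

module Tours (k : ℕ) (d : Fin (KStar.n k) → Fin (KStar.n k) → ℚ) (met : IsMetric d) where
  open Sums
  open Walks
  open Schedule
  open import Data.Nat as ℕ using (ℕ; zero; suc; _<_; s≤s; _≡ᵇ_)
  import Data.Nat.Properties as ℕP
  open import Data.Nat.DivMod using (_%_; m<n⇒m%n≡m; [m+n]%n≡m%n)
  open import Data.Nat.Solver using () renaming (module +-*-Solver to ℕSolver)
  open import Data.Bool using (true; false; if_then_else_; T)
  open import Data.Product using (_,_)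
  open import Relation.Nullary using (yes; no)
  open import Data.Rational using (ℚ; 0ℚ; 1ℚ; ½; _+_; _*_; _-_; _≤_)
  import Data.Rational.Properties as QP
  open import Data.Rational.Solver using (module +-*-Solver)
  open import Relation.Binary.PropositionalEquality

  open KStar k
  open Metric d met
  open ClosedWalks D

  tour : ℕ → ℚ
  tour t = tourLength (venue t) P

  star : ℕ → ℚ
  star t = starSum t (venue t) P

  %N-below : ∀ x → x < N → x % N ≡ x
  %N-below x = m<n⇒m%n≡m

  N+t%N : ∀ t → t < N → (N ℕ.+ t) % N ≡ t
  N+t%N t t<N = trans (cong (_% N) (ℕP.+-comm N t)) (trans ([m+n]%n≡m%n t N) (%N-below t t<N))

  -- edge x → x+1 (mod N) of the Hamilton cycle v_0, …, v_{N-1} = 0, …, N-1, and its length τ′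
  cycleStep : ℕ → ℚ
  cycleStep x = D (x % N) (suc x % N)

  cycleStep-periodic : ∀ x → cycleStep (x ℕ.+ N) ≡ cycleStep x
  cycleStep-periodic x = cong₂ D ([m+n]%n≡m%n x N) ([m+n]%n≡m%n (suc x) N)

  τ′ : ℚ
  τ′ = Σ< N cycleStep

  τ′-from : ∀ t → τ′ ≡ cycleStep t + Σ< (h ℕ.+ h) (λ i → cycleStep (suc i ℕ.+ t))
  τ′-from t = trans (sym (Σ-rotate N cycleStep cycleStep-periodic t)) (Σ-head (h ℕ.+ h) (λ s → cycleStep (s ℕ.+ t)))

  -- the cycle with its edge x → x+1 replaced by the detour x → v* → x+1
  detour : ℕ → ℚ
  detour x = τ′ - cycleStep x + D (x % N) N + D N (suc x % N)

  detour-periodic : ∀ x → detour (x ℕ.+ N) ≡ detour x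
  detour-periodic x =
    cong₂ (λ a b → τ′ - D a b + D a N + D N b) ([m+n]%n≡m%n x N) ([m+n]%n≡m%n (suc x) N)

  -- A team t ≤ h tours t → N → t+1 → … → t+2h → t: the cycle with edge t → t+1 detoured.
  tour-low : ∀ t → t ℕ.≤ h → tour t ≡ detour t
  tour-low t t≤h = begin
      tour t
    ≡⟨ tour-AwayThenHome D-zero (h ℕ.+ h) t (lowStart t) (venue t) (lowTrip t) (venue-periodic t) (low-awayThenHome t t≤h) ⟩
      Σ< (h ℕ.+ h) (λ j → D (lowTrip t j) (lowTrip t (suc j))) + D (lowTrip t (h ℕ.+ h)) t + D t N
    ≡⟨ cong (λ z → z + D (lowTrip t (h ℕ.+ h)) t + D t N) (Σ-head M (λ j → D (lowTrip t j) (lowTrip t (suc j)))) ⟩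
      D N (suc t % N) + Σ< M (λ i → cycleStep (suc i ℕ.+ t)) + D (lowTrip t (h ℕ.+ h)) t + D t N
    ≡⟨ cong (λ z → D N (suc t % N) + Σ< M (λ i → cycleStep (suc i ℕ.+ t)) + D (lowTrip t (h ℕ.+ h)) z + D t N)
            (sym (N+t%N t t<N)) ⟩
      D N (suc t % N) + Σ< M (λ i → cycleStep (suc i ℕ.+ t)) + cycleStep (suc M ℕ.+ t) + D t N
    ≡⟨ solve 5 (λ a b c e y → a :+ b :+ c :+ e := (y :+ (b :+ c)) :- y :+ e :+ a) refl
         (D N (suc t % N)) (Σ< M (λ i → cycleStep (suc i ℕ.+ t))) (cycleStep (suc M ℕ.+ t)) (D t N) (cycleStep t) ⟩
      (cycleStep t + Σ< (h ℕ.+ h) (λ i → cycleStep (suc i ℕ.+ t))) - cycleStep t + D t N + D N (suc t % N)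
    ≡⟨ cong₂ (λ a b → a - cycleStep t + D b N + D N (suc t % N)) (sym (τ′-from t)) (sym (%N-below t t<N)) ⟩
      detour t ∎
    where
    open ≡-Reasoning
    open +-*-Solver
    M : ℕ
    M = k ℕ.+ suc k
    t<N : t < N
    t<N = s≤s (ℕP.≤-trans t≤h (ℕP.m≤m+n h h))

  edgeBeforeHigh≡ : ∀ u → suc (k ℕ.+ suc k) ℕ.+ (suc h ℕ.+ u) ≡ (h ℕ.+ u) ℕ.+ N
  edgeBeforeHigh≡ u = solve 2 (λ h u → (h :+ h) :+ (con 1 :+ h :+ u) := (h :+ u) :+ (con 1 :+ (h :+ h))) refl h u
    where open ℕSolver

  -- A team t = h+1+u tours t → t+1 → … → t+2h → N → t: the cycle with edge t-1 → t detoured.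
  tour-high : ∀ u → u < h → tour (suc h ℕ.+ u) ≡ detour (h ℕ.+ u)
  tour-high u u<h = begin
      tour t
    ≡⟨ tour-AwayThenHome D-zero (h ℕ.+ h) t (highStart u) (venue t) (highTrip t) (venue-periodic t) (high-awayThenHome u u<h) ⟩
      Σ< (h ℕ.+ h) (λ j → D (highTrip t j) (highTrip t (suc j))) + D (highTrip t (h ℕ.+ h)) t + D t (highTrip t 0)
    ≡⟨ cong₂ (λ a b → a + D b t + D t (suc t % N)) awayPath (if-false (<ᵇ-false (ℕP.≤-refl {h ℕ.+ h}))) ⟩
      Σ< M (λ i → cycleStep (suc i ℕ.+ t)) + D (x % N) N + D N t + D t (suc t % N)
    ≡⟨ cong₂ (λ a b → Σ< M (λ i → cycleStep (suc i ℕ.+ t)) + D (x % N) N + D N a + D b (suc t % N))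
             (sym (N+t%N t t<N)) (sym (%N-below t t<N)) ⟩
      Σ< M (λ i → cycleStep (suc i ℕ.+ t)) + D (x % N) N + D N (suc x % N) + cycleStep t
    ≡⟨ solve 5 (λ s a b c y → s :+ a :+ b :+ c := (c :+ (s :+ y)) :- y :+ a :+ b) refl
         (Σ< M (λ i → cycleStep (suc i ℕ.+ t))) (D (x % N) N) (D N (suc x % N)) (cycleStep t) (cycleStep x) ⟩
      (cycleStep t + Σ< (h ℕ.+ h) (λ i → cycleStep (suc i ℕ.+ t))) - cycleStep x + D (x % N) N + D N (suc x % N)
    ≡⟨ cong (λ a → a - cycleStep x + D (x % N) N + D N (suc x % N)) (sym (τ′-from t)) ⟩
      detour x
    ≡⟨ cong detour (edgeBeforeHigh≡ u) ⟩
      detour ((h ℕ.+ u) ℕ.+ N)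
    ≡⟨ detour-periodic (h ℕ.+ u) ⟩
      detour (h ℕ.+ u) ∎
    where
    open ≡-Reasoning
    open +-*-Solver
    t : ℕ
    t = suc h ℕ.+ u
    M : ℕ
    M = k ℕ.+ suc k
    x : ℕ
    x = suc M ℕ.+ t
    t<N : t < N
    t<N = s≤s (ℕP.+-monoʳ-< h u<h)
    awayPath : Σ< (h ℕ.+ h) (λ j → D (highTrip t j) (highTrip t (suc j))) ≡ Σ< M (λ i → cycleStep (suc i ℕ.+ t)) + D (x % N) N
    awayPath = cong₂ _+_
      (Σ-cong M (λ j j<M → cong₂ D (if-true (<ᵇ-true (ℕP.<-trans j<M (ℕP.n<1+n M)))) (if-true (<ᵇ-true (s≤s j<M)))))
      (cong₂ D (if-true (<ᵇ-true (ℕP.n<1+n M))) (if-false (<ᵇ-false (ℕP.≤-refl {h ℕ.+ h}))))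

  -- Team N's tour has n legs, each at most τ/2.
  tour-last : ∀ τ → IsShortestHamCycleLength d τ → tour N ≤ (ℕ→ℚ n * τ) * ½
  tour-last τ shortest = begin
      tour N
    ≡⟨ tour-AwayThenHome D-zero (h ℕ.+ h) N 0 (venue N) (Kstar n N) (venue-periodic N) last-awayThenHome ⟩
      Σ< (h ℕ.+ h) (λ j → D (Kstar n N j) (Kstar n N (suc j))) + D (Kstar n N (h ℕ.+ h)) N + D N (Kstar n N 0)
    ≤⟨ QP.+-mono-≤ (QP.+-mono-≤ (Σ-mono (h ℕ.+ h) (λ j _ → leg (Kstar n N j) (Kstar n N (suc j))))
                               (leg (Kstar n N (h ℕ.+ h)) N)) (leg N (Kstar n N 0)) ⟩
      Σ< (h ℕ.+ h) (λ _ → ½ * τ) + ½ * τ + ½ * τ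
    ≡⟨ cong (λ z → z + ½ * τ + ½ * τ) (Σ-const (h ℕ.+ h) (½ * τ)) ⟩
      ℕ→ℚ (h ℕ.+ h) * (½ * τ) + ½ * τ + ½ * τ
    ≡⟨ solve 2 (λ m t → m :* (con ½ :* t) :+ con ½ :* t :+ con ½ :* t := (con 1ℚ :+ (con 1ℚ :+ m)) :* t :* con ½)
             refl (ℕ→ℚ (h ℕ.+ h)) τ ⟩
      (1ℚ + (1ℚ + ℕ→ℚ (h ℕ.+ h))) * τ * ½
    ≡⟨ cong (λ z → z * τ * ½) (sym (trans (ℕ→ℚ-suc (suc (h ℕ.+ h))) (cong (1ℚ +_) (ℕ→ℚ-suc (h ℕ.+ h))))) ⟩
      (ℕ→ℚ n * τ) * ½ ∎
    where
    open QP.≤-Reasoning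
    open +-*-Solver
    leg : ∀ u v → D u v ≤ ½ * τ
    leg = D≤½τ τ shortest

  -- star sums: every team visits every other venue exactly once per period
  rowSum≡ : ∀ t → rowSum d t ≡ Σ< N (D t) + D t N
  rowSum≡ t = Σ-cong′ n excludeSelf
    where
    excludeSelf : ∀ v → (if v ≡ᵇ t then 0ℚ else D t v) ≡ D t v
    excludeSelf v with v ≡ᵇ t in eq
    ... | true = trans (sym (D-zero t)) (cong (D t) (sym (ℕP.≡ᵇ⇒≡ v t (subst T (sym eq) _))))
    ... | false = refl

  Σ-from : ∀ t → t < N → Σ< N (D t) ≡ Σ< (h ℕ.+ h) (λ i → D t ((suc i ℕ.+ t) % N))
  Σ-from t t<N = begin
      Σ< N (D t)
    ≡⟨ Σ-cong N (λ v v<N → cong (D t) (sym (%N-below v v<N))) ⟩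
      Σ< N (λ v → D t (v % N))
    ≡⟨ sym (Σ-rotate N (λ v → D t (v % N)) (λ x → cong (D t) ([m+n]%n≡m%n x N)) t) ⟩
      Σ< N (λ s → D t ((s ℕ.+ t) % N))
    ≡⟨ Σ-head (h ℕ.+ h) (λ s → D t ((s ℕ.+ t) % N)) ⟩
      D t (t % N) + Σ< (h ℕ.+ h) (λ i → D t ((suc i ℕ.+ t) % N))
    ≡⟨ cong (_+ Σ< (h ℕ.+ h) (λ i → D t ((suc i ℕ.+ t) % N))) (trans (cong (D t) (%N-below t t<N)) (D-zero t)) ⟩
      0ℚ + Σ< (h ℕ.+ h) (λ i → D t ((suc i ℕ.+ t) % N))
    ≡⟨ QP.+-identityˡ _ ⟩
      Σ< (h ℕ.+ h) (λ i → D t ((suc i ℕ.+ t) % N)) ∎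
    where open ≡-Reasoning

  -- team t ≤ h visits N first; team h+1+u visits N last
  star-low : ∀ t → t ℕ.≤ h → star t ≡ rowSum d t
  star-low t t≤h = begin
      star t
    ≡⟨ star-AwayThenHome D-zero (h ℕ.+ h) t (lowStart t) (venue t) (lowTrip t) (venue-periodic t) (low-awayThenHome t t≤h) ⟩
      Σ< N (λ j → D t (lowTrip t j))
    ≡⟨ Σ-head (h ℕ.+ h) (λ j → D t (lowTrip t j)) ⟩
      D t N + Σ< (h ℕ.+ h) (λ i → D t ((suc i ℕ.+ t) % N))
    ≡⟨ trans (QP.+-comm (D t N) _) (cong (_+ D t N) (sym (Σ-from t t<N))) ⟩
      Σ< N (D t) + D t N
    ≡⟨ sym (rowSum≡ t) ⟩
      rowSum d t ∎
    where
    open ≡-Reasoning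
    t<N : t < N
    t<N = s≤s (ℕP.≤-trans t≤h (ℕP.m≤m+n h h))

  star-high : ∀ u → u < h → star (suc h ℕ.+ u) ≡ rowSum d (suc h ℕ.+ u)
  star-high u u<h = begin
      star t
    ≡⟨ star-AwayThenHome D-zero (h ℕ.+ h) t (highStart u) (venue t) (highTrip t) (venue-periodic t) (high-awayThenHome u u<h) ⟩
      Σ< (h ℕ.+ h) (λ j → D t (highTrip t j)) + D t (highTrip t (h ℕ.+ h))
    ≡⟨ cong₂ _+_ (Σ-cong (h ℕ.+ h) (λ j j<2h → cong (D t) (if-true (<ᵇ-true j<2h))))
                 (cong (D t) (if-false (<ᵇ-false (ℕP.≤-refl {h ℕ.+ h})))) ⟩
      Σ< (h ℕ.+ h) (λ i → D t ((suc i ℕ.+ t) % N)) + D t N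
    ≡⟨ cong (_+ D t N) (sym (Σ-from t (s≤s (ℕP.+-monoʳ-< h u<h)))) ⟩
      Σ< N (D t) + D t N
    ≡⟨ sym (rowSum≡ t) ⟩
      rowSum d t ∎
    where
    open ≡-Reasoning
    t : ℕ
    t = suc h ℕ.+ u

  -- team N visits 0, h+1, 1, h+2, …, h-1, 2h, h
  star-last : star N ≡ rowSum d N
  star-last = begin
      star N
    ≡⟨ star-AwayThenHome D-zero (h ℕ.+ h) N 0 (venue N) (Kstar n N) (venue-periodic N) last-awayThenHome ⟩
      Σ< (h ℕ.+ h) (λ s → D N (Kstar n N s)) + D N (Kstar n N (h ℕ.+ h))
    ≡⟨ cong₂ _+_ (alternating h) (cong (D N) (Kstar-last-even h)) ⟩
      Σ< h (D N) + Σ< h (λ i → D N (suc h ℕ.+ i)) + D N h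
    ≡⟨ solve 3 (λ a b c → a :+ b :+ c := a :+ c :+ b) refl (Σ< h (D N)) (Σ< h (λ i → D N (suc h ℕ.+ i))) (D N h) ⟩
      Σ< (suc h) (D N) + Σ< h (λ i → D N (suc h ℕ.+ i))
    ≡⟨ sym (Σ-split (suc h) h (D N)) ⟩
      Σ< N (D N)
    ≡⟨ sym (trans (rowSum≡ N) (trans (cong (Σ< N (D N) +_) (D-zero N)) (QP.+-identityʳ _))) ⟩
      rowSum d N ∎
    where
    open ≡-Reasoning
    open +-*-Solver
    alternating : ∀ j → Σ< (j ℕ.+ j) (λ s → D N (Kstar n N s)) ≡ Σ< j (D N) + Σ< j (λ i → D N (suc h ℕ.+ i))
    alternating zero = refl
    alternating (suc j) rewrite ℕP.+-suc j j | alternating j | Kstar-last-even j | Kstar-last-odd j =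
      solve 4 (λ a b c e → a :+ b :+ c :+ e := a :+ c :+ (b :+ e)) refl
        (Σ< j (D N)) (Σ< j (λ i → D N (suc h ℕ.+ i))) (D N j) (D N (suc h ℕ.+ j))

  star≡rowSum : ∀ t → t < n → star t ≡ rowSum d t
  star≡rowSum t t<n with t ℕ.≤? h
  ... | yes t≤h = star-low t t≤h
  ... | no t≰h with t ℕ.<? N
  ...   | yes t<N with ℕP.m≤n⇒∃[o]m+o≡n (ℕP.≰⇒> t≰h)
  ...     | u , refl = star-high u (ℕP.+-cancelˡ-< (suc h) u h t<N)
  star≡rowSum t t<n | no _ | no t≮N with ℕP.≤-antisym (ℕP.≤-pred t<n) (ℕP.≮⇒≥ t≮N)
  ...     | refl = star-last

module Average (k : ℕ) (d : Fin (KStar.n k) → Fin (KStar.n k) → ℚ) (met : IsMetric d) where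
  open Sums
  open Walks
  open Schedule
  open import Data.Nat as ℕ using (ℕ; suc; s≤s)
  import Data.Nat.Properties as ℕP
  open import Data.Nat.DivMod using (_%_; [m+n]%n≡m%n; n%n≡0)
  open import Data.List using (upTo)
  open import Data.Integer using (+_)
  open import Data.Rational as Q using (ℚ; 0ℚ; 1ℚ; ½; _+_; _*_; _-_; -_; _≤_)
  import Data.Rational.Properties as QP
  open import Data.Rational.Solver using (module +-*-Solver)
  open import Relation.Binary.PropositionalEquality

  open KStar k
  open Metric d met
  open ClosedWalks D
  open Tours k d met

  τ′≡cycLen : cycLen D (upTo N) ≡ τ′
  τ′≡cycLen = begin
      cycLen D (upTo N)
    ≡⟨ cong₂ _+_ (pathLen-applyUpTo (h ℕ.+ h) (λ i → i)) (cong (λ z → D z 0) (lastOr-applyUpTo (h ℕ.+ h) (λ i → i))) ⟩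
      Σ< (h ℕ.+ h) (λ i → D i (suc i)) + D (h ℕ.+ h) 0
    ≡⟨ cong₂ _+_ (Σ-cong (h ℕ.+ h) (λ i i<2h → cong₂ D (sym (%N-below i (ℕP.m<n⇒m<1+n i<2h)))
                                                        (sym (%N-below (suc i) (s≤s i<2h)))))
                 (cong₂ D (sym (%N-below (h ℕ.+ h) ℕP.≤-refl)) (sym (n%n≡0 N))) ⟩
      τ′ ∎
    where open ≡-Reasoning

  Sv : ℚ
  Sv = Σ< N (λ v → D v N)

  Σ-detour : Σ< N detour ≡ ℕ→ℚ (h ℕ.+ h) * τ′ + (Sv + Sv)
  Σ-detour = begin
      Σ< N detour
    ≡⟨ Σ-+ N (λ x → τ′ - cycleStep x + D (x % N) N) (λ x → D N (suc x % N)) ⟩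
      Σ< N (λ x → τ′ - cycleStep x + D (x % N) N) + Σ< N (λ x → D N (suc x % N))
    ≡⟨ cong (_+ Σ< N (λ x → D N (suc x % N))) (Σ-+ N (λ x → τ′ - cycleStep x) (λ x → D (x % N) N)) ⟩
      Σ< N (λ x → τ′ - cycleStep x) + Σ< N (λ x → D (x % N) N) + Σ< N (λ x → D N (suc x % N))
    ≡⟨ cong₂ (λ a b → a + Σ< N (λ x → D (x % N) N) + b) (Σ-+ N (λ _ → τ′) (λ x → - cycleStep x)) fromV* ⟩
      Σ< N (λ _ → τ′) + Σ< N (λ x → - cycleStep x) + Σ< N (λ x → D (x % N) N) + Sv
    ≡⟨ cong₂ (λ a b → a + b + Σ< N (λ x → D (x % N) N) + Sv) (Σ-const N τ′) (Σ-neg N cycleStep) ⟩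
      ℕ→ℚ N * τ′ + - τ′ + Σ< N (λ x → D (x % N) N) + Sv
    ≡⟨ cong₂ (λ a b → a * τ′ + - τ′ + b + Sv) (ℕ→ℚ-suc (h ℕ.+ h))
             (Σ-cong N (λ x x<N → cong (λ z → D z N) (%N-below x x<N))) ⟩
      (1ℚ + ℕ→ℚ (h ℕ.+ h)) * τ′ + - τ′ + Sv + Sv
    ≡⟨ solve 3 (λ m t s → (con 1ℚ :+ m) :* t :+ (:- t) :+ s :+ s := m :* t :+ (s :+ s)) refl (ℕ→ℚ (h ℕ.+ h)) τ′ Sv ⟩
      ℕ→ℚ (h ℕ.+ h) * τ′ + (Sv + Sv) ∎
    where
    open ≡-Reasoning
    open +-*-Solver
    fromV* : Σ< N (λ x → D N (suc x % N)) ≡ Sv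
    fromV* = trans (Σ-cong′ N (λ x → cong (λ z → D N (z % N)) (ℕP.+-comm 1 x)))
               (trans (Σ-rotate N (λ x → D N (x % N)) (λ x → cong (D N) ([m+n]%n≡m%n x N)) 1)
                      (Σ-cong N (λ x x<N → trans (cong (D N) (%N-below x x<N)) (D-sym N x))))

  -- teams 0, …, h detour the edges 0, …, h and teams h+1, …, 2h the edges h, …, 2h-1
  Σ-tour-ordinary : Σ< N tour + detour (h ℕ.+ h) ≡ Σ< N detour + detour (h ℕ.+ 0)
  Σ-tour-ordinary = begin
      Σ< N tour + detour (h ℕ.+ h)
    ≡⟨ cong (_+ detour (h ℕ.+ h)) (Σ-split (suc h) h tour) ⟩
      Σ< (suc h) tour + Σ< h (λ u → tour (suc h ℕ.+ u)) + detour (h ℕ.+ h)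
    ≡⟨ cong₂ (λ a b → a + b + detour (h ℕ.+ h)) (Σ-cong (suc h) (λ t t≤h → tour-low t (ℕP.≤-pred t≤h)))
                                                (Σ-cong h (λ u u<h → tour-high u u<h)) ⟩
      Σ< (suc h) detour + Σ< h (λ u → detour (h ℕ.+ u)) + detour (h ℕ.+ h)
    ≡⟨ QP.+-assoc (Σ< (suc h) detour) (Σ< h (λ u → detour (h ℕ.+ u))) (detour (h ℕ.+ h)) ⟩
      Σ< (suc h) detour + Σ< (suc h) (λ u → detour (h ℕ.+ u))
    ≡⟨ cong (λ z → Σ< (suc h) detour + z) (Σ-head h (λ u → detour (h ℕ.+ u))) ⟩
      Σ< (suc h) detour + (detour (h ℕ.+ 0) + Σ< h (λ u → detour (h ℕ.+ suc u)))
    ≡⟨ cong (λ z → Σ< (suc h) detour + (detour (h ℕ.+ 0) + z)) (Σ-cong′ h (λ u → cong detour (ℕP.+-suc h u))) ⟩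
      Σ< (suc h) detour + (detour (h ℕ.+ 0) + Σ< h (λ u → detour (suc h ℕ.+ u)))
    ≡⟨ solve 3 (λ a b c → a :+ (b :+ c) := a :+ c :+ b) refl
         (Σ< (suc h) detour) (detour (h ℕ.+ 0)) (Σ< h (λ u → detour (suc h ℕ.+ u))) ⟩
      Σ< (suc h) detour + Σ< h (λ u → detour (suc h ℕ.+ u)) + detour (h ℕ.+ 0)
    ≡⟨ cong (_+ detour (h ℕ.+ 0)) (sym (Σ-split (suc h) h detour)) ⟩
      Σ< N detour + detour (h ℕ.+ 0) ∎
    where
    open ≡-Reasoning
    open +-*-Solver

  -- number of legs of an open walk in K*_DRR(m): P slots, P - 1 moves between them
  legs : ℕ
  legs = 2 ℕ.* n ℕ.∸ 3

  rotations≡P : suc legs ≡ P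
  rotations≡P = cong (λ p → suc (ℕ.pred p)) slots≡P

  -- teamDist d m t is, by the definition of loc, the walk of team t through rotation m;
  -- over all rotations it covers its tour legs times and each home distance twice
  Σ-teamDist : ∀ t → Σ< (2 ℕ.* n ℕ.∸ 2) (λ m → teamDist d m t) ≡ ℕ→ℚ legs * tour t + (star t + star t)
  Σ-teamDist t = begin
      Σ< (suc legs) (walkFrom t (venue t) legs)
    ≡⟨ Σ-walkFrom D-sym legs (venue t) (subst (λ p → Periodic p (venue t)) (sym rotations≡P) (venue-periodic t)) t ⟩
      ℕ→ℚ legs * tourLength (venue t) (suc legs) + (starSum t (venue t) (suc legs) + starSum t (venue t) (suc legs))
    ≡⟨ cong (λ p → ℕ→ℚ legs * tourLength (venue t) p + (starSum t (venue t) p + starSum t (venue t) p)) rotations≡P ⟩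
      ℕ→ℚ legs * tour t + (star t + star t) ∎
    where open ≡-Reasoning

  average≡ : avgTotalDist d ≡ recip P * (ℕ→ℚ legs * Σ< n tour + (Σ< n star + Σ< n star))
  average≡ = begin
      recip (2 ℕ.* n ℕ.∸ 2) * Σ< (2 ℕ.* n ℕ.∸ 2) (λ m → Σ< n (teamDist d m))
    ≡⟨ cong₂ (λ a b → recip a * b) slots≡P (Σ-swap (2 ℕ.* n ℕ.∸ 2) n (λ m t → teamDist d m t)) ⟩
      recip P * Σ< n (λ t → Σ< (2 ℕ.* n ℕ.∸ 2) (λ m → teamDist d m t))
    ≡⟨ cong (recip P *_) (Σ-cong′ n Σ-teamDist) ⟩
      recip P * Σ< n (λ t → ℕ→ℚ legs * tour t + (star t + star t))
    ≡⟨ cong (recip P *_) (trans (Σ-+ n (λ t → ℕ→ℚ legs * tour t) (λ t → star t + star t))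
                                (cong₂ _+_ (sym (Σ-scale n (ℕ→ℚ legs) tour)) (Σ-+ n star star))) ⟩
      recip P * (ℕ→ℚ legs * Σ< n tour + (Σ< n star + Σ< n star)) ∎
    where open ≡-Reasoning

  legs/P≤1 : recip P * ℕ→ℚ legs ≤ 1ℚ
  legs/P≤1 = QP.≤-trans
    (QP.*-monoˡ-≤-nonNeg (recip P) {{Q.nonNegative (recip-nonneg P)}}
                         (ℕ→ℚ-mono (ℕP.≤-trans (ℕP.n≤1+n legs) (ℕP.≤-reflexive rotations≡P))))
    (QP.≤-reflexive (recip-inverse ((h ℕ.+ h) ℕ.+ N)))

  2/P≡1/N : recip P * (1ℚ + 1ℚ) ≡ recip N
  2/P≡1/N = begin
      recip P * (1ℚ + 1ℚ)
    ≡⟨ sym (QP.*-identityʳ _) ⟩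
      recip P * (1ℚ + 1ℚ) * 1ℚ
    ≡⟨ cong (recip P * (1ℚ + 1ℚ) *_) (sym (trans (QP.*-comm (ℕ→ℚ N) (recip N)) (recip-inverse (h ℕ.+ h)))) ⟩
      recip P * (1ℚ + 1ℚ) * (ℕ→ℚ N * recip N)
    ≡⟨ solve 3 (λ r x s → r :* (con 1ℚ :+ con 1ℚ) :* (x :* s) := r :* (x :+ x) :* s) refl (recip P) (ℕ→ℚ N) (recip N) ⟩
      recip P * (ℕ→ℚ N + ℕ→ℚ N) * recip N
    ≡⟨ cong (λ z → recip P * z * recip N) (sym (ℕ→ℚ-+ N N)) ⟩
      recip P * ℕ→ℚ P * recip N
    ≡⟨ cong (_* recip N) (recip-inverse ((h ℕ.+ h) ℕ.+ N)) ⟩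
      1ℚ * recip N
    ≡⟨ QP.*-identityˡ _ ⟩
      recip N ∎
    where
    open ≡-Reasoning
    open +-*-Solver

  module _ (τ : ℚ) (shortest : IsShortestHamCycleLength d τ) where

    -- the two detours differ by at most three distances, each at most τ/2
    detour-difference : detour (h ℕ.+ 0) - detour (h ℕ.+ h) ≤ ((+ 3) Q./ 2) * τ
    detour-difference = begin
        detour a - detour b
      ≡⟨ solve 7 (λ T ca cb x1 x2 x3 x4 → (T :- ca :+ x1 :+ x2) :- (T :- cb :+ x3 :+ x4)
                                          := (x1 :+ x2 :+ cb) :+ (:- (ca :+ x3 :+ x4)))
               refl τ′ (cycleStep a) (cycleStep b) (D (a % N) N) (D N (suc a % N)) (D (b % N) N) (D N (suc b % N)) ⟩
        (D (a % N) N + D N (suc a % N) + cycleStep b) + - (cycleStep a + D (b % N) N + D N (suc b % N))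
      ≤⟨ QP.+-monoʳ-≤ (D (a % N) N + D N (suc a % N) + cycleStep b) (QP.neg-antimono-≤ dropped-nonneg) ⟩
        (D (a % N) N + D N (suc a % N) + cycleStep b) + - 0ℚ
      ≤⟨ QP.+-monoˡ-≤ (- 0ℚ) (QP.+-mono-≤ (QP.+-mono-≤ (leg (a % N) N) (leg N (suc a % N))) (leg (b % N) (suc b % N))) ⟩
        ½ * τ + ½ * τ + ½ * τ + - 0ℚ
      ≡⟨ solve 1 (λ t → con ½ :* t :+ con ½ :* t :+ con ½ :* t :+ (:- con 0ℚ) := con ((+ 3) Q./ 2) :* t) refl τ ⟩
        ((+ 3) Q./ 2) * τ ∎
      where
      open QP.≤-Reasoning
      open +-*-Solver
      a : ℕ
      a = h ℕ.+ 0
      b : ℕ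
      b = h ℕ.+ h
      leg : ∀ u v → D u v ≤ ½ * τ
      leg = D≤½τ τ shortest
      dropped-nonneg : 0ℚ ≤ cycleStep a + D (b % N) N + D N (suc b % N)
      dropped-nonneg = 0≤+ (0≤+ (D-nonneg (a % N) (suc a % N)) (D-nonneg (b % N) N)) (D-nonneg N (suc b % N))

    Σ-tour : Σ< n tour ≤ ℕ→ℚ (h ℕ.+ h) * τ′ + (Sv + Sv) + ((+ 3) Q./ 2) * τ + (ℕ→ℚ n * τ) * ½
    Σ-tour = begin
        Σ< N tour + tour N
      ≡⟨ cong (_+ tour N) (begin-equality
            Σ< N tour
          ≡⟨ solve 2 (λ x c → x := (x :+ c) :- c) refl (Σ< N tour) (detour (h ℕ.+ h)) ⟩
            (Σ< N tour + detour (h ℕ.+ h)) - detour (h ℕ.+ h)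
          ≡⟨ cong (_- detour (h ℕ.+ h)) (trans Σ-tour-ordinary (cong (_+ detour (h ℕ.+ 0)) Σ-detour)) ⟩
            (ℕ→ℚ (h ℕ.+ h) * τ′ + (Sv + Sv) + detour (h ℕ.+ 0)) - detour (h ℕ.+ h)
          ≡⟨ solve 3 (λ a e f → (a :+ e) :- f := a :+ (e :- f)) refl
                     (ℕ→ℚ (h ℕ.+ h) * τ′ + (Sv + Sv)) (detour (h ℕ.+ 0)) (detour (h ℕ.+ h)) ⟩
            ℕ→ℚ (h ℕ.+ h) * τ′ + (Sv + Sv) + (detour (h ℕ.+ 0) - detour (h ℕ.+ h)) ∎) ⟩
        ℕ→ℚ (h ℕ.+ h) * τ′ + (Sv + Sv) + (detour (h ℕ.+ 0) - detour (h ℕ.+ h)) + tour N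
      ≤⟨ QP.+-mono-≤ (QP.+-monoʳ-≤ (ℕ→ℚ (h ℕ.+ h) * τ′ + (Sv + Sv)) detour-difference) (tour-last τ shortest) ⟩
        ℕ→ℚ (h ℕ.+ h) * τ′ + (Sv + Sv) + ((+ 3) Q./ 2) * τ + (ℕ→ℚ n * τ) * ½ ∎
      where
      open QP.≤-Reasoning
      open +-*-Solver

    average-bound : avgTotalDist d ≤ bound d τ
    average-bound = begin
        avgTotalDist d
      ≡⟨ average≡ ⟩
        recip P * (ℕ→ℚ legs * C + (S + S))
      ≡⟨ solve 4 (λ r q c a → r :* (q :* c :+ (a :+ a)) := (r :* q) :* c :+ (r :* (con 1ℚ :+ con 1ℚ)) :* a)
               refl (recip P) (ℕ→ℚ legs) C S ⟩
        (recip P * ℕ→ℚ legs) * C + (recip P * (1ℚ + 1ℚ)) * S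
      ≡⟨ cong₂ (λ a b → (recip P * ℕ→ℚ legs) * C + a * b) 2/P≡1/N (Σ-cong n star≡rowSum) ⟩
        (recip P * ℕ→ℚ legs) * C + recip N * R
      ≤⟨ QP.+-monoˡ-≤ (recip N * R) (QP.≤-trans (QP.*-monoʳ-≤-nonNeg C {{Q.nonNegative C-nonneg}} legs/P≤1)
                                               (QP.≤-reflexive (QP.*-identityˡ C))) ⟩
        C + recip N * R
      ≤⟨ QP.+-monoˡ-≤ (recip N * R) Σ-tour ⟩
        ℕ→ℚ (h ℕ.+ h) * τ′ + (Sv + Sv) + ((+ 3) Q./ 2) * τ + (ℕ→ℚ n * τ) * ½ + recip N * R
      ≡⟨ cong₂ (λ a b → ℕ→ℚ (h ℕ.+ h) * a + b + ((+ 3) Q./ 2) * τ + (ℕ→ℚ n * τ) * ½ + recip N * R)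
               (sym τ′≡cycLen) (solve 1 (λ s → s :+ s := con (ℕ→ℚ 2) :* s) refl Sv) ⟩
        bound d τ ∎
      where
      open QP.≤-Reasoning
      open +-*-Solver
      C : ℚ
      C = Σ< n tour
      S : ℚ
      S = Σ< n star
      R : ℚ
      R = Σ< n (rowSum d)
      C-nonneg : 0ℚ ≤ C
      C-nonneg = Σ-nonneg n tour (λ t → Σ-nonneg P _ (λ s → D-nonneg (venue t s) (venue t (suc s))))

open import Data.Nat using (zero; suc; _*_; _∸_; s≤s)
open import Data.Nat.Divisibility using (_∣_; divides)
open import Data.Nat.Solver using (module +-*-Solver)
open import Data.List using (upTo)
open import Data.Product using (Σ; _,_)
open import Relation.Binary.PropositionalEquality using (_≡_; refl)

even≥4 : ∀ n q → 4 Data.Nat.≤ n → n ≡ q * 2 → Σ ℕ (λ k → n ≡ KStar.n k)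
even≥4 n zero () refl
even≥4 n (suc zero) (s≤s (s≤s ())) refl
even≥4 n (suc (suc k)) _ refl = k , solve 1 (λ k → (con 2 :+ k) :* con 2 := con 2 :+ ((con 1 :+ k) :+ (con 1 :+ k))) refl k
  where open +-*-Solver

theorem1 : (n : ℕ) → 4 Data.Nat.≤ n → 2 ∣ n →
    (d : Fin n → Fin n → ℚ) → IsMetric d → IsVStar d →
    ChristofidesOutput (upTo (n ∸ 1)) (dℕ d) (upTo (n ∸ 1)) →
    (τ : ℚ) → IsShortestHamCycleLength d τ →
    avgTotalDist d Data.Rational.≤ bound d τ
theorem1 n 4≤n (divides q n≡2q) d met _ _ τ shortest with even≥4 n q 4≤n n≡2q
... | k , refl = Average.average-bound k d met τ shortest
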